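{- For every $k\in\mathbb{N}$ there exists $C<\infty$ such that the following holds. Let $U\subseteq[n]\times[k]$ with $|U|=u$, and let $M$ be a uniformly random element of $\mathrm{PHM}(m,k,n)$ with $m=\alpha n$. Then for all $\kappa,\eta\in\mathbb{N}$, \[\Pr[\kappa(U,M)=\kappa,\ \eta(U,M)=\eta]\le p_{C,\alpha}(n,u,\kappa,\eta)\coloneqq\alpha^{\kappa}C^{u}\Big(\frac{u}{n}\Big)^{\eta/2}\] when $\kappa+\eta\le u$, and the probability is $0$ otherwise.
   Context: $\mathrm{PHM}(m,k,n)$ is the set of matrices $M\in[n]^{m\times k}$ each of whose columns has distinct entries; the $j$-th edge of $M$ is $e_j=\{(M_{j,\ell},\ell):\ell\in[k]\}\subseteq[n]\times[k]$. Define $K(U,M)=\{j\in[m]:|e_j\cap U|=1\}$, $D(U,M)=\{j\in[m]:|e_j\cap U|\ge2\}$, $\kappa(U,M)=|K(U,M)|$, and $\eta(U,M)=|U\cap\bigcup_{j\in D(U,M)}e_j|$. -}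

module Defs where

open import Data.Nat using (ℕ; zero; suc; NonZero)
open import Data.Bool using (Bool; true; false; _∧_; _∨_; not; if_then_else_)
open import Data.Fin using (Fin)
open import Data.Fin.Properties using (_≟_)
open import Data.List using (List; []; _∷_; map; concatMap; filter; length; allFin)
open import Data.Bool.ListAction using (any; all)
open import Data.Integer using (+_)
open import Data.Rational using (ℚ; _/_; _*_; 1ℚ)
open import Relation.Nullary.Decidable using (⌊_⌋)
open import Relation.Binary.PropositionalEquality using (_≡_)

countFin : (a : ℕ) → (Fin a → Bool) → ℕ
countFin a P = length (filter (λ x → Data.Bool._≟_ (P x) true) (allFin a))

Matrix : ℕ → ℕ → ℕ → Set
Matrix m k n = Fin m → Fin k → Fin n

allFuns : {A : Set} → (a : ℕ) → List A → List (Fin a → A)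
allFuns zero xs = (λ ()) ∷ []
allFuns (suc a) xs =
  concatMap (λ x → map (λ f → λ { Fin.zero → x ; (Fin.suc i) → f i }) (allFuns a xs)) xs

allMatrices : (m k n : ℕ) → List (Matrix m k n)
allMatrices m k n = allFuns m (allFuns k (allFin n))

isPHM : {m k n : ℕ} → Matrix m k n → Bool
isPHM {m} {k} M =
  all (λ ℓ → all (λ j → all (λ j' →
        ⌊ j ≟ j' ⌋ ∨ not ⌊ M j ℓ ≟ M j' ℓ ⌋) (allFin m)) (allFin m)) (allFin k)

PHM : (m k n : ℕ) → List (Matrix m k n)
PHM m k n = filter (λ M → Data.Bool._≟_ (isPHM M) true) (allMatrices m k n)

SubsetNK : ℕ → ℕ → Set
SubsetNK n k = Fin n → Fin k → Bool

card : {n k : ℕ} → SubsetNK n k → ℕ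
card {n} {k} U = length (filter (λ p → Data.Bool._≟_ (U (Data.Product.proj₁ p) (Data.Product.proj₂ p)) true)
                          (concatMap (λ i → map (λ ℓ → i Data.Product., ℓ) (allFin k)) (allFin n)))
  where import Data.Product

-- |e_j ∩ U|, where e_j = {(M j ℓ, ℓ) : ℓ ∈ [k]}
edgeMeet : {m k n : ℕ} → SubsetNK n k → Matrix m k n → Fin m → ℕ
edgeMeet {k = k} U M j = countFin k (λ ℓ → U (M j ℓ) ℓ)

isOne : ℕ → Bool
isOne (suc zero) = true
isOne _ = false

atLeastTwo : ℕ → Bool
atLeastTwo (suc (suc _)) = true
atLeastTwo _ = false

inK : {m k n : ℕ} → SubsetNK n k → Matrix m k n → Fin m → Bool
inK U M j = isOne (edgeMeet U M j)

inD : {m k n : ℕ} → SubsetNK n k → Matrix m k n → Fin m → Bool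
inD U M j = atLeastTwo (edgeMeet U M j)

kappa : {m k n : ℕ} → SubsetNK n k → Matrix m k n → ℕ
kappa {m} U M = countFin m (inK U M)

inUnionD : {m k n : ℕ} → SubsetNK n k → Matrix m k n → Fin n → Fin k → Bool
inUnionD {m} U M i ℓ = any (λ j → inD U M j ∧ ⌊ M j ℓ ≟ i ⌋) (allFin m)

eta : {m k n : ℕ} → SubsetNK n k → Matrix m k n → ℕ
eta U M = card (λ i ℓ → U i ℓ ∧ inUnionD U M i ℓ)

countEvent : (m k n : ℕ) → SubsetNK n k → ℕ → ℕ → ℕ
countEvent m k n U κ η =
  length (filter (λ M → Data.Bool._≟_ (⌊ Data.Nat._≟_ (kappa U M) κ ⌋ ∧ ⌊ Data.Nat._≟_ (eta U M) η ⌋) true)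
                 (PHM m k n))
  where import Data.Nat

prob : (m k n : ℕ) → .{{NonZero (length (PHM m k n))}} → SubsetNK n k → ℕ → ℕ → ℚ
prob m k n U κ η = (+ countEvent m k n U κ η) / length (PHM m k n)

_^_ : ℚ → ℕ → ℚ
q ^ zero = 1ℚ
q ^ suc e = q * (q ^ e)

module Submission where

-- Count matrices instead of computing probabilities.  Given M, label each point of U
-- on an edge j of M: "lone j" if e_j meets U once (j ∈ K), and if e_j meets U at least twice
-- (j ∈ D) "anchor j" at its first such point and otherwise "follower q", where q is the position
-- of that anchor in the list of points of U.  A labelling with κ lone labels, b anchors and
-- η − b followers demands M r ℓ = i at κ + η distinct points (i , ℓ), r being the row the label
-- names, and exchanging two values within a column is a bijection of PHM(m,k,n), so at most a
-- fraction 1/n(n−1)⋯(n−κ−η+1) of the matrices realise it.  There are at most 4^u m^(κ+b) u^(η−b) such labellings and 2b ≤ η, since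
-- every edge in D meets U at least twice.  Summing over b and squaring, to avoid the square root in
-- (u/n)^(η/2), gives the claim with C = 16 when 4u ≤ n.  When n < 4u the factor (u/n)^(η/2) is
-- harmless: labelling only the lone points works if 2κ ≤ n, and if 2κ > n then κ ≤ m gives
-- n ≤ 2m, which makes the trivial bound enough.

open import Data.Bool using (Bool; true; false; _∧_; _∨_; not; T)
import Data.Bool as Bool
open import Data.Bool.ListAction using (all; any; and)
open import Data.Bool.Properties using (T-∧)
open import Data.Empty using (⊥-elim)
open import Data.Fin using (Fin; toℕ)
open import Data.Fin.Permutation using (Permutation; _⟨$⟩ʳ_; _⟨$⟩ˡ_; inverseˡ; transpose)
import Data.Fin.Permutation as Perm
open import Data.Fin.Properties using (_≟_; any?; toℕ<n; injective⇒≤)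
open import Data.List
  using (List; []; _∷_; _++_; _?∷_; map; concatMap; filter; length; allFin; upTo; tabulate; cartesianProduct)
open import Data.List.Membership.Propositional using (_∈_; _∉_)
open import Data.List.Membership.Propositional.Properties
  using (∈-allFin; ∈-map⁺; ∈-++⁺ˡ; ∈-++⁺ʳ; ∈-upTo⁺; ∈-filter⁺; ∈-filter⁻; ∈-concatMap⁺)
open import Data.List.Properties using (map-cong; length-map; length-tabulate; length-upTo; length-filter)
open import Data.List.Relation.Unary.All using (All; []; _∷_)
import Data.List.Relation.Unary.All as All
import Data.List.Relation.Unary.All.Properties as All
open import Data.List.Relation.Unary.Any using (here; there; index)
import Data.List.Relation.Unary.Any as Any
open import Data.List.Relation.Unary.Unique.Propositional using (Unique; []; _∷_)
import Data.List.Relation.Unary.Unique.Propositional.Properties as Unique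
open import Data.Maybe using (Maybe; just; nothing; Is-just)
import Data.Maybe as Maybe
open import Data.Maybe.Properties using (just-injective)
open import Data.Maybe.Relation.Unary.Any using (just)
open import Data.Nat
  using (ℕ; zero; suc; _+_; _*_; _∸_; _≤_; _<_; _>_; _≤ᵇ_; _≤?_; z≤n; s≤s; s≤s⁻¹; NonZero; >-nonZero⁻¹)
open import Data.Nat.Combinatorics.Base using (_P′_)
open import Data.Nat.Properties hiding (_≟_)
open import Data.Nat.Properties using () renaming (_≟_ to _≟ℕ_)
open import Algebra.Properties.CommutativeSemigroup +-commutativeSemigroup using () renaming (interchange to +-interchange)
open import Algebra.Properties.CommutativeSemigroup *-commutativeSemigroup using (x∙yz≈y∙xz)
import Algebra.Properties.CommutativeMonoid.Sum +-0-commutativeMonoid as FinSum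
open import Data.Product using (∃; _×_; _,_; proj₁; proj₂)
open import Data.Product.Properties using (≡-dec)
open import Data.Sum using (inj₁; inj₂)
open import Data.Unit using (⊤; tt)
open import Data.Vec.Functional using () renaming (_∷_ to _◂_)
open import Function using (_∘_; id; mk⇔; Equivalence)
open import Relation.Binary.Definitions using (DecidableEquality)
open import Relation.Binary.PropositionalEquality
open import Relation.Nullary using (Dec; does; yes; no)
open import Relation.Nullary.Decidable using (dec-true; dec-false; does-⇔; isYes≗does; ⌊_⌋; toWitness)
open import Defs hiding (_^_)

private variable
  A B : Set

-- Finite sums

∑ : List A → (A → ℕ) → ℕ
∑ [] f = 0
∑ (x ∷ xs) f = f x + ∑ xs f

syntax ∑ xs (λ x → e) = ∑[ x ∈ xs ] e

𝟙 : Bool → ℕ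
𝟙 true = 1
𝟙 false = 0

∑-cong : ∀ (xs : List A) {f g : A → ℕ} → (∀ x → f x ≡ g x) → ∑ xs f ≡ ∑ xs g
∑-cong [] f≗g = refl
∑-cong (x ∷ xs) f≗g = cong₂ _+_ (f≗g x) (∑-cong xs f≗g)

∑-mono : ∀ (xs : List A) {f g : A → ℕ} → (∀ x → f x ≤ g x) → ∑ xs f ≤ ∑ xs g
∑-mono [] f≤g = z≤n
∑-mono (x ∷ xs) f≤g = +-mono-≤ (f≤g x) (∑-mono xs f≤g)

∑-mono-∈ : ∀ (xs : List A) {f g : A → ℕ} → (∀ {x} → x ∈ xs → f x ≤ g x) → ∑ xs f ≤ ∑ xs g
∑-mono-∈ [] f≤g = z≤n
∑-mono-∈ (x ∷ xs) f≤g = +-mono-≤ (f≤g (here refl)) (∑-mono-∈ xs (f≤g ∘ there))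

∑-++ : ∀ (xs ys : List A) (f : A → ℕ) → ∑ (xs ++ ys) f ≡ ∑ xs f + ∑ ys f
∑-++ [] ys f = refl
∑-++ (x ∷ xs) ys f = trans (cong (f x +_) (∑-++ xs ys f)) (sym (+-assoc (f x) _ _))

∑-distrib-+ : ∀ (xs : List A) (f g : A → ℕ) → ∑[ x ∈ xs ] (f x + g x) ≡ ∑ xs f + ∑ xs g
∑-distrib-+ [] f g = refl
∑-distrib-+ (x ∷ xs) f g = trans (cong (f x + g x +_) (∑-distrib-+ xs f g)) (+-interchange (f x) (g x) _ _)

∑-*ˡ : ∀ (xs : List A) (c : ℕ) (f : A → ℕ) → ∑[ x ∈ xs ] (c * f x) ≡ c * ∑ xs f
∑-*ˡ [] c f = sym (*-zeroʳ c)
∑-*ˡ (x ∷ xs) c f = trans (cong (c * f x +_) (∑-*ˡ xs c f)) (sym (*-distribˡ-+ c (f x) _))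

∑-*ʳ : ∀ (xs : List A) (f : A → ℕ) (c : ℕ) → ∑[ x ∈ xs ] (f x * c) ≡ ∑ xs f * c
∑-*ʳ xs f c = trans (∑-cong xs (λ x → *-comm (f x) c)) (trans (∑-*ˡ xs c f) (*-comm c (∑ xs f)))

∑-const : ∀ (xs : List A) (c : ℕ) → ∑[ x ∈ xs ] c ≡ length xs * c
∑-const [] c = refl
∑-const (x ∷ xs) c = cong (c +_) (∑-const xs c)

∑-zero : ∀ (xs : List A) → ∑[ x ∈ xs ] 0 ≡ 0
∑-zero [] = refl
∑-zero (x ∷ xs) = ∑-zero xs

∑-one : ∀ (xs : List A) → ∑[ x ∈ xs ] 1 ≡ length xs
∑-one xs = trans (∑-const xs 1) (*-identityʳ (length xs))

∑-≤-length* : ∀ (xs : List A) {f : A → ℕ} {c : ℕ} → (∀ x → f x ≤ c) → ∑ xs f ≤ length xs * c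
∑-≤-length* xs {c = c} f≤c = ≤-trans (∑-mono xs f≤c) (≤-reflexive (∑-const xs c))

∑-map : ∀ (g : A → B) (xs : List A) (f : B → ℕ) → ∑ (map g xs) f ≡ ∑ xs (f ∘ g)
∑-map g [] f = refl
∑-map g (x ∷ xs) f = cong (f (g x) +_) (∑-map g xs f)

∑-concatMap : ∀ (g : A → List B) (xs : List A) (f : B → ℕ) →
  ∑ (concatMap g xs) f ≡ ∑[ x ∈ xs ] ∑ (g x) f
∑-concatMap g [] f = refl
∑-concatMap g (x ∷ xs) f = trans (∑-++ (g x) (concatMap g xs) f) (cong (∑ (g x) f +_) (∑-concatMap g xs f))

∑-comm : ∀ (xs : List A) (ys : List B) (f : A → B → ℕ) →
  ∑[ x ∈ xs ] ∑[ y ∈ ys ] f x y ≡ ∑[ y ∈ ys ] ∑[ x ∈ xs ] f x y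
∑-comm [] ys f = sym (∑-zero ys)
∑-comm (x ∷ xs) ys f =
  trans (cong (∑ ys (f x) +_) (∑-comm xs ys f)) (sym (∑-distrib-+ ys (f x) (λ y → ∑[ x ∈ xs ] f x y)))

*-≤-of-squares : ∀ {a b y} → a * a ≤ y → b * b ≤ y → a * b ≤ y
*-≤-of-squares {a} {b} aa≤y bb≤y with ≤-total a b
... | inj₁ a≤b = ≤-trans (*-monoˡ-≤ b a≤b) bb≤y
... | inj₂ b≤a = ≤-trans (*-monoʳ-≤ a b≤a) aa≤y

∑-square-≤ : ∀ (xs : List A) (w : A → ℕ) {y} → (∀ x x' → w x * w x' ≤ y) →
  ∑ xs w * ∑ xs w ≤ length xs * (length xs * y)
∑-square-≤ xs w {y} ww≤y = begin
  ∑ xs w * ∑ xs w                          ≡⟨ ∑-*ʳ xs w (∑ xs w) ⟨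
  ∑[ x ∈ xs ] (w x * ∑ xs w)               ≡⟨ ∑-cong xs (λ x → ∑-*ˡ xs (w x) w) ⟨
  ∑[ x ∈ xs ] ∑[ x' ∈ xs ] (w x * w x')    ≤⟨ ∑-≤-length* xs (λ x → ∑-≤-length* xs (ww≤y x)) ⟩
  length xs * (length xs * y)              ∎
  where open ≤-Reasoning

∑-member : ∀ {x : A} {xs : List A} (f : A → ℕ) → x ∈ xs → f x ≤ ∑ xs f
∑-member {xs = y ∷ xs} f (here refl) = m≤m+n (f y) (∑ xs f)
∑-member {xs = y ∷ xs} f (there x∈xs) = ≤-trans (∑-member f x∈xs) (m≤n+m (∑ xs f) (f y))

𝟙≤1 : ∀ b → 𝟙 b ≤ 1
𝟙≤1 true = ≤-refl
𝟙≤1 false = z≤n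

𝟙-∧ : ∀ a b → 𝟙 (a ∧ b) ≡ 𝟙 a * 𝟙 b
𝟙-∧ true b = sym (+-identityʳ (𝟙 b))
𝟙-∧ false b = refl

𝟙+𝟙-not : ∀ b → 𝟙 b + 𝟙 (not b) ≡ 1
𝟙+𝟙-not true = refl
𝟙+𝟙-not false = refl

∑-filter : ∀ (p : A → Bool) (xs : List A) (f : A → ℕ) →
  ∑ (filter (λ x → p x Bool.≟ true) xs) f ≡ ∑[ x ∈ xs ] (𝟙 (p x) * f x)
∑-filter p [] f = refl
∑-filter p (x ∷ xs) f with p x
... | true = cong₂ _+_ (sym (+-identityʳ (f x))) (∑-filter p xs f)
... | false = ∑-filter p xs f

length-filter≡∑ : ∀ (p : A → Bool) (xs : List A) →
  length (filter (λ x → p x Bool.≟ true) xs) ≡ ∑[ x ∈ xs ] 𝟙 (p x)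
length-filter≡∑ p xs = trans (sym (∑-one (filter (λ x → p x Bool.≟ true) xs)))
  (trans (∑-filter p xs (λ _ → 1)) (∑-cong xs (λ x → *-identityʳ (𝟙 (p x)))))

𝟙-any : ∀ (g : A → Bool) xs → ∑[ x ∈ xs ] 𝟙 (g x) ≤ 1 → 𝟙 (any g xs) ≡ ∑[ x ∈ xs ] 𝟙 (g x)
𝟙-any g [] _ = refl
𝟙-any g (x ∷ xs) ≤1 with g x
... | true = cong suc (sym (n≤0⇒n≡0 (s≤s⁻¹ ≤1)))
... | false = 𝟙-any g xs ≤1

𝟙-T : ∀ {b} → T b → 𝟙 b ≡ 1
𝟙-T {true} _ = refl

union-bound : ∀ (xs : List A) (p : A → Bool) (cs : List B) (w : B → ℕ) (q : B → A → Bool) →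
  (∀ {x} → x ∈ xs → T (p x) → 1 ≤ ∑[ c ∈ cs ] (w c * 𝟙 (q c x))) →
  ∑[ x ∈ xs ] 𝟙 (p x) ≤ ∑[ c ∈ cs ] (w c * ∑[ x ∈ xs ] 𝟙 (q c x))
union-bound xs p cs w q covered = begin
  ∑[ x ∈ xs ] 𝟙 (p x)                        ≤⟨ ∑-mono-∈ xs pointwise ⟩
  ∑[ x ∈ xs ] ∑[ c ∈ cs ] (w c * 𝟙 (q c x))  ≡⟨ ∑-comm xs cs _ ⟩
  ∑[ c ∈ cs ] ∑[ x ∈ xs ] (w c * 𝟙 (q c x))  ≡⟨ ∑-cong cs (λ c → ∑-*ˡ xs (w c) (𝟙 ∘ q c)) ⟩
  ∑[ c ∈ cs ] (w c * ∑[ x ∈ xs ] 𝟙 (q c x))  ∎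
  where
  open ≤-Reasoning
  pointwise : ∀ {x} → x ∈ xs → 𝟙 (p x) ≤ ∑[ c ∈ cs ] (w c * 𝟙 (q c x))
  pointwise {x} x∈xs with p x in px
  ... | true = covered x∈xs (subst T (sym px) tt)
  ... | false = z≤n

∑-𝟙-witness : ∀ (p : A → Bool) xs → 1 ≤ ∑[ x ∈ xs ] 𝟙 (p x) → ∃ λ x → x ∈ xs × T (p x)
∑-𝟙-witness p (x ∷ xs) 1≤ with p x in px
... | true = x , here refl , subst T (sym px) tt
... | false with ∑-𝟙-witness p xs 1≤
...   | y , y∈xs , py = y , there y∈xs , py

∈-nonempty : ∀ (xs : List A) → 1 ≤ length xs → ∃ (_∈ xs)
∈-nonempty (x ∷ xs) _ = x , here refl

length-allFin : ∀ m → length (allFin m) ≡ m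
length-allFin m = length-tabulate id

allLists : ℕ → List A → List (List A)
allLists zero xs = [] ∷ []
allLists (suc t) xs = concatMap (λ x → map (x ∷_) (allLists t xs)) xs

∑-allLists-suc : ∀ t (xs : List A) (g : List A → ℕ) →
  ∑ (allLists (suc t) xs) g ≡ ∑[ x ∈ xs ] ∑[ L ∈ allLists t xs ] g (x ∷ L)
∑-allLists-suc t xs g = trans (∑-concatMap _ xs g) (∑-cong xs (λ x → ∑-map (x ∷_) (allLists t xs) g))

∑-allLists-member : ∀ (xs : List A) (g : List A → ℕ) L → All (_∈ xs) L → g L ≤ ∑ (allLists (length L) xs) g
∑-allLists-member xs g [] [] = m≤m+n (g []) 0
∑-allLists-member xs g (x ∷ L) (x∈xs ∷ L⊆xs) = begin
  g (x ∷ L)                                              ≤⟨ ∑-allLists-member xs (g ∘ (x ∷_)) L L⊆xs ⟩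
  ∑[ L' ∈ allLists (length L) xs ] g (x ∷ L')
    ≤⟨ ∑-member (λ y → ∑[ L' ∈ allLists (length L) xs ] g (y ∷ L')) x∈xs ⟩
  ∑[ y ∈ xs ] ∑[ L' ∈ allLists (length L) xs ] g (y ∷ L') ≡⟨ ∑-allLists-suc (length L) xs g ⟨
  ∑ (allLists (suc (length L)) xs) g                     ∎
  where open ≤-Reasoning

all-cong : ∀ {p q : A → Bool} → (∀ x → p x ≡ q x) → ∀ xs → all p xs ≡ all q xs
all-cong {p = p} {q} p≗q xs = cong and (map-cong {f = p} {g = q} p≗q xs)

T-all-allFin : ∀ {n} {p : Fin n → Bool} → T (all p (allFin n)) → ∀ i → T (p i)
T-all-allFin {p = p} t i = All.lookup (All.all⁺ p (allFin _) t) (∈-allFin i)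

-- Sums over Fin n and over function spaces

∑-tabulate : ∀ {n} (g : Fin n → A) (f : A → ℕ) → ∑ (tabulate g) f ≡ ∑[ i ∈ allFin n ] f (g i)
∑-tabulate {n = zero} g f = refl
∑-tabulate {n = suc n} g f =
  cong (f (g Fin.zero) +_) (trans (∑-tabulate (g ∘ Fin.suc) f) (sym (∑-tabulate Fin.suc (f ∘ g))))

∑-allFin-suc : ∀ {n} (f : Fin (suc n) → ℕ) →
  ∑ (allFin (suc n)) f ≡ f Fin.zero + ∑[ i ∈ allFin n ] f (Fin.suc i)
∑-allFin-suc f = cong (f Fin.zero +_) (∑-tabulate Fin.suc f)

∑-allFin≡sum : ∀ {n} (f : Fin n → ℕ) → ∑ (allFin n) f ≡ FinSum.sum f
∑-allFin≡sum {zero} f = refl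
∑-allFin≡sum {suc n} f = trans (∑-allFin-suc f) (cong (f Fin.zero +_) (∑-allFin≡sum (f ∘ Fin.suc)))

∑-permute : ∀ {n} (π : Permutation n n) (f : Fin n → ℕ) →
  ∑[ i ∈ allFin n ] f (π ⟨$⟩ʳ i) ≡ ∑ (allFin n) f
∑-permute π f =
  trans (∑-allFin≡sum (f ∘ (π ⟨$⟩ʳ_))) (trans (sym (FinSum.∑-permute f π)) (sym (∑-allFin≡sum f)))

δ : ∀ {n} → Fin n → Fin n → ℕ
δ i j = 𝟙 (does (i ≟ j))

∑-δ : ∀ {n} (i : Fin n) (f : Fin n → ℕ) → ∑[ j ∈ allFin n ] (δ i j * f j) ≡ f i
∑-δ {suc n} Fin.zero f =
  trans (∑-allFin-suc (λ j → δ Fin.zero j * f j))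
    (trans (cong₂ _+_ (+-identityʳ (f Fin.zero)) (∑-zero (allFin n))) (+-identityʳ (f Fin.zero)))
∑-δ {suc n} (Fin.suc i) f = trans (∑-allFin-suc (λ j → δ (Fin.suc i) j * f j)) (∑-δ i (f ∘ Fin.suc))

∑-δ-one : ∀ {n} (i : Fin n) → ∑[ j ∈ allFin n ] δ i j ≡ 1
∑-δ-one i = trans (∑-cong (allFin _) (λ j → sym (*-identityʳ (δ i j)))) (∑-δ i (λ _ → 1))

module _ {A : Set} (_≈_ : A → A → Set) (≈-refl : ∀ {x} → x ≈ x) where

  RespectsPointwise : ∀ {a} → ((Fin a → A) → ℕ) → Set
  RespectsPointwise {a} H = ∀ {f g : Fin a → A} → (∀ i → f i ≈ g i) → H f ≡ H g

  ∑-allFuns-suc : ∀ a (xs : List A) (H : (Fin (suc a) → A) → ℕ) → RespectsPointwise H →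
    ∑ (allFuns (suc a) xs) H ≡ ∑[ x ∈ xs ] ∑[ f ∈ allFuns a xs ] H (x ◂ f)
  ∑-allFuns-suc a xs H resp = trans (∑-concatMap _ xs H) (∑-cong xs λ x →
    trans (∑-map _ (allFuns a xs) H) (∑-cong (allFuns a xs) λ f →
      resp λ { Fin.zero → ≈-refl ; (Fin.suc i) → ≈-refl }))

  ∑-allFuns-invariant : ∀ a (xs : List A) (ρ : Fin a → A → A) →
    (∀ i {x y} → x ≈ y → ρ i x ≈ ρ i y) →
    (∀ i (G : A → ℕ) → (∀ {x y} → x ≈ y → G x ≡ G y) → ∑[ x ∈ xs ] G (ρ i x) ≡ ∑ xs G) →
    (H : (Fin a → A) → ℕ) → RespectsPointwise H →
    ∑[ f ∈ allFuns a xs ] H (λ i → ρ i (f i)) ≡ ∑ (allFuns a xs) H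
  ∑-allFuns-invariant zero xs ρ ρ-resp ρ-inv H resp = cong (_+ 0) (resp λ ())
  ∑-allFuns-invariant (suc a) xs ρ ρ-resp ρ-inv H resp = begin
    ∑[ f ∈ allFuns (suc a) xs ] H (λ i → ρ i (f i))
      ≡⟨ ∑-allFuns-suc a xs _ (λ f≈g → resp (λ i → ρ-resp i (f≈g i))) ⟩
    ∑[ x ∈ xs ] ∑[ f ∈ allFuns a xs ] H (λ i → ρ i ((x ◂ f) i))
      ≡⟨ ∑-cong xs (λ x → ∑-cong (allFuns a xs) λ f → resp λ { Fin.zero → ≈-refl ; (Fin.suc i) → ≈-refl }) ⟩
    ∑[ x ∈ xs ] ∑[ f ∈ allFuns a xs ] H (ρ Fin.zero x ◂ (λ i → ρ (Fin.suc i) (f i)))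
      ≡⟨ ∑-cong xs (λ x → ∑-allFuns-invariant a xs (ρ ∘ Fin.suc) (ρ-resp ∘ Fin.suc) (ρ-inv ∘ Fin.suc)
           (λ f → H (ρ Fin.zero x ◂ f)) (λ f≈g → resp λ { Fin.zero → ≈-refl ; (Fin.suc i) → f≈g i })) ⟩
    ∑[ x ∈ xs ] ∑[ f ∈ allFuns a xs ] H (ρ Fin.zero x ◂ f)
      ≡⟨ ρ-inv Fin.zero (λ y → ∑[ f ∈ allFuns a xs ] H (y ◂ f))
           (λ x≈y → ∑-cong (allFuns a xs) λ f → resp λ { Fin.zero → x≈y ; (Fin.suc i) → ≈-refl }) ⟩
    ∑[ x ∈ xs ] ∑[ f ∈ allFuns a xs ] H (x ◂ f)
      ≡⟨ ∑-allFuns-suc a xs H resp ⟨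
    ∑ (allFuns (suc a) xs) H ∎
    where open ≡-Reasoning

relabel : ∀ {m k n} → (Fin k → Permutation n n) → Matrix m k n → Matrix m k n
relabel σ M j ℓ = σ ℓ ⟨$⟩ʳ M j ℓ

∑-allMatrices-relabel : ∀ {m k n} (σ : Fin k → Permutation n n) (H : Matrix m k n → ℕ) →
  (∀ {M M'} → (∀ j ℓ → M j ℓ ≡ M' j ℓ) → H M ≡ H M') →
  ∑[ M ∈ allMatrices m k n ] H (relabel σ M) ≡ ∑ (allMatrices m k n) H
∑-allMatrices-relabel {m} {k} {n} σ H resp =
  ∑-allFuns-invariant (λ r r' → ∀ ℓ → r ℓ ≡ r' ℓ) (λ ℓ → refl) m (allFuns k (allFin n))
    (λ _ r ℓ → σ ℓ ⟨$⟩ʳ r ℓ) (λ _ r≈r' ℓ → cong (σ ℓ ⟨$⟩ʳ_) (r≈r' ℓ))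
    (λ _ G G-resp → ∑-allFuns-invariant _≡_ refl k (allFin n) (λ ℓ → σ ℓ ⟨$⟩ʳ_) (λ ℓ → cong (σ ℓ ⟨$⟩ʳ_))
       (λ ℓ G' _ → ∑-permute (σ ℓ) G') G G-resp)
    H (λ M≈M' → resp M≈M')

-- Matrices whose columns have distinct entries

Point : ℕ → ℕ → Set
Point n k = Fin n × Fin k

_≟ₚ_ : ∀ {n k} → DecidableEquality (Point n k)
_≟ₚ_ = ≡-dec _≟_ _≟_

does-≟-permute : ∀ {n} (π : Permutation n n) x y → does (π ⟨$⟩ʳ x ≟ π ⟨$⟩ʳ y) ≡ does (x ≟ y)
does-≟-permute π x y = does-⇔ (mk⇔ injective (cong (π ⟨$⟩ʳ_))) (π ⟨$⟩ʳ x ≟ π ⟨$⟩ʳ y) (x ≟ y)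
  where
  injective : π ⟨$⟩ʳ x ≡ π ⟨$⟩ʳ y → x ≡ y
  injective e = trans (sym (inverseˡ π)) (trans (cong (π ⟨$⟩ˡ_) e) (inverseˡ π))

isPHM-cong : ∀ {m k n} {M M' : Matrix m k n} →
  (∀ ℓ j j' → does (M j ℓ ≟ M j' ℓ) ≡ does (M' j ℓ ≟ M' j' ℓ)) → isPHM M ≡ isPHM M'
isPHM-cong {m} {k} {M = M} {M'} same = all-cong (λ ℓ → all-cong (λ j → all-cong (λ j' →
  cong (⌊ j ≟ j' ⌋ ∨_) (cong not (trans (isYes≗does (M j ℓ ≟ M j' ℓ))
    (trans (same ℓ j j') (sym (isYes≗does (M' j ℓ ≟ M' j' ℓ))))))) (allFin m)) (allFin m)) (allFin k)

isPHM-relabel : ∀ {m k n} (σ : Fin k → Permutation n n) (M : Matrix m k n) → isPHM (relabel σ M) ≡ isPHM M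
isPHM-relabel σ M = isPHM-cong (λ ℓ j j' → does-≟-permute (σ ℓ) (M j ℓ) (M j' ℓ))

phm-column-injective : ∀ {m k n} {M : Matrix m k n} → T (isPHM M) →
  ∀ ℓ {j j'} → M j ℓ ≡ M j' ℓ → j ≡ j'
phm-column-injective {M = M} phm ℓ {j} {j'} e
  with j ≟ j' | M j ℓ ≟ M j' ℓ | T-all-allFin (T-all-allFin (T-all-allFin phm ℓ) j) j'
... | yes j≡j' | _ | _ = j≡j'
... | no _ | yes _ | ()
... | no _ | no ¬e | _ = ⊥-elim (¬e e)

Constraint : ℕ → ℕ → ℕ → Set
Constraint m k n = Fin m × Point n k

satisfies : ∀ {m k n} → Matrix m k n → Constraint m k n → Bool
satisfies M (r , i , ℓ) = does (M r ℓ ≟ i)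

cells : ∀ {m k n} → List (Constraint m k n) → List (Point n k)
cells = map proj₂

FixedBy : ∀ {m k n} → (Fin k → Permutation n n) → Constraint m k n → Set
FixedBy σ (r , i , ℓ) = σ ℓ ⟨$⟩ʳ i ≡ i

satisfies-relabel : ∀ {m k n} (σ : Fin k → Permutation n n) (M : Matrix m k n) ψ →
  All (FixedBy σ) ψ → all (satisfies (relabel σ M)) ψ ≡ all (satisfies M) ψ
satisfies-relabel σ M [] [] = refl
satisfies-relabel σ M ((r , i , ℓ) ∷ ψ) (fixed ∷ fixeds) =
  cong₂ _∧_ (trans (cong (λ v → does (σ ℓ ⟨$⟩ʳ M r ℓ ≟ v)) (sym fixed))
                   (does-≟-permute (σ ℓ) (M r ℓ) i))
            (satisfies-relabel σ M ψ fixeds)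

transposeAt : ∀ {k n} → Fin k → Fin n → Fin n → Fin k → Permutation n n
transposeAt ℓ i i' ℓ' with ℓ' ≟ ℓ
... | yes _ = transpose i i'
... | no _ = Perm.id

transposeAt-moves : ∀ {k n} (ℓ : Fin k) (i i' : Fin n) → transposeAt ℓ i i' ℓ ⟨$⟩ʳ i ≡ i'
transposeAt-moves ℓ i i' with ℓ ≟ ℓ
... | no ℓ≢ℓ = ⊥-elim (ℓ≢ℓ refl)
... | yes _ rewrite dec-true (i ≟ i) refl = refl

transposeAt-fixes : ∀ {k n} (ℓ : Fin k) (i i' : Fin n) ℓ' v →
  (v , ℓ') ≢ (i , ℓ) → (v , ℓ') ≢ (i' , ℓ) → transposeAt ℓ i i' ℓ' ⟨$⟩ʳ v ≡ v
transposeAt-fixes ℓ i i' ℓ' v ≢i ≢i' with ℓ' ≟ ℓ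
... | no _ = refl
... | yes refl rewrite dec-false (v ≟ i) (≢i ∘ cong (_, ℓ)) | dec-false (v ≟ i') (≢i' ∘ cong (_, ℓ)) = refl

module _ {n k : ℕ} where
  open import Data.List.Membership.DecPropositional (_≟ₚ_ {n} {k}) using (_∈?_)

  𝟙-∈?-≤ : ∀ (p : Point n k) ps → 𝟙 (does (p ∈? ps)) ≤ ∑[ q ∈ ps ] 𝟙 (does (p ≟ₚ q))
  𝟙-∈?-≤ p [] = z≤n
  𝟙-∈?-≤ p (q ∷ ps) with does (p ≟ₚ q)
  ... | true = s≤s z≤n
  ... | false = 𝟙-∈?-≤ p ps

  free-values : ∀ ℓ (ps : List (Point n k)) →
    n ≤ length ps + ∑[ i ∈ allFin n ] 𝟙 (not (does ((i , ℓ) ∈? ps)))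
  free-values ℓ ps = begin
    n                                                      ≡⟨ length-allFin n ⟨
    length (allFin n)                                      ≡⟨ ∑-one (allFin n) ⟨
    ∑[ i ∈ allFin n ] 1                                    ≡⟨ ∑-cong (allFin n) (λ i → 𝟙+𝟙-not (used i)) ⟨
    ∑[ i ∈ allFin n ] (𝟙 (used i) + 𝟙 (not (used i)))      ≡⟨ ∑-distrib-+ (allFin n) _ _ ⟩
    ∑[ i ∈ allFin n ] 𝟙 (used i) + #free                   ≤⟨ +-monoˡ-≤ #free used≤ ⟩
    length ps + #free ∎
    where
    open ≤-Reasoning
    used : Fin n → Bool
    used i = does ((i , ℓ) ∈? ps)
    #free = ∑[ i ∈ allFin n ] 𝟙 (not (used i))
    hits-≤ : ∀ (q : Point n k) → ∑[ i ∈ allFin n ] 𝟙 (does ((i , ℓ) ≟ₚ q)) ≤ 1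
    hit-≤-δ : ∀ i' ℓ' i → 𝟙 (does ((i , ℓ) ≟ₚ (i' , ℓ'))) ≤ δ i' i * 1
    hit-≤-δ i' ℓ' i with (i , ℓ) ≟ₚ (i' , ℓ')
    ... | no _ = z≤n
    ... | yes refl rewrite dec-true (i ≟ i) refl = ≤-refl
    hits-≤ (i' , ℓ') = ≤-trans (∑-mono (allFin n) (hit-≤-δ i' ℓ')) (≤-reflexive (∑-δ i' (λ _ → 1)))
    used≤ : ∑[ i ∈ allFin n ] 𝟙 (used i) ≤ length ps
    used≤ = begin
      ∑[ i ∈ allFin n ] 𝟙 (used i)                           ≤⟨ ∑-mono (allFin n) (λ i → 𝟙-∈?-≤ (i , ℓ) ps) ⟩
      ∑[ i ∈ allFin n ] ∑[ q ∈ ps ] 𝟙 (does ((i , ℓ) ≟ₚ q))  ≡⟨ ∑-comm (allFin n) ps _ ⟩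
      ∑[ q ∈ ps ] ∑[ i ∈ allFin n ] 𝟙 (does ((i , ℓ) ≟ₚ q))  ≤⟨ ∑-≤-length* ps hits-≤ ⟩
      length ps * 1                                          ≡⟨ *-identityʳ (length ps) ⟩
      length ps ∎

module _ {m k n : ℕ} where
  open import Data.List.Membership.DecPropositional (_≟ₚ_ {n} {k}) using (_∈?_)

  #PHM : (Matrix m k n → Bool) → ℕ
  #PHM Q = ∑[ M ∈ PHM m k n ] 𝟙 (Q M)

  #PHM-allMatrices : ∀ Q → #PHM Q ≡ ∑[ M ∈ allMatrices m k n ] 𝟙 (isPHM M ∧ Q M)
  #PHM-allMatrices Q =
    trans (∑-filter isPHM (allMatrices m k n) (𝟙 ∘ Q))
          (∑-cong (allMatrices m k n) (λ M → sym (𝟙-∧ (isPHM M) (Q M))))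

  #satisfying : List (Constraint m k n) → ℕ
  #satisfying ψ = #PHM (λ M → all (satisfies M) ψ)

  #satisfying-swap : ∀ r ℓ {i i'} ψ → (i , ℓ) ∉ cells ψ → (i' , ℓ) ∉ cells ψ →
    #satisfying ((r , i' , ℓ) ∷ ψ) ≡ #satisfying ((r , i , ℓ) ∷ ψ)
  #satisfying-swap r ℓ {i} {i'} ψ i∉ψ i'∉ψ = begin
    #satisfying ((r , i' , ℓ) ∷ ψ)                       ≡⟨ #PHM-allMatrices _ ⟩
    ∑[ M ∈ allMatrices m k n ] H M                       ≡⟨ ∑-allMatrices-relabel σ H H-resp ⟨
    ∑[ M ∈ allMatrices m k n ] H (relabel σ M)           ≡⟨ ∑-cong (allMatrices m k n) H∘relabel ⟩
    ∑[ M ∈ allMatrices m k n ] 𝟙 (isPHM M ∧ all (satisfies M) ((r , i , ℓ) ∷ ψ)) ≡⟨ #PHM-allMatrices _ ⟨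
    #satisfying ((r , i , ℓ) ∷ ψ)                        ∎
    where
    open ≡-Reasoning
    σ = transposeAt ℓ i i'
    H : Matrix m k n → ℕ
    H M = 𝟙 (isPHM M ∧ all (satisfies M) ((r , i' , ℓ) ∷ ψ))
    H-resp : ∀ {M M'} → (∀ j ℓ → M j ℓ ≡ M' j ℓ) → H M ≡ H M'
    H-resp {M} {M'} M≈M' = cong 𝟙 (cong₂ _∧_
      (isPHM-cong λ ℓ j j' → cong₂ (λ a b → does (a ≟ b)) (M≈M' j ℓ) (M≈M' j' ℓ))
      (all-cong (λ { (r , v , ℓ) → cong (λ a → does (a ≟ v)) (M≈M' r ℓ) }) ((r , i' , ℓ) ∷ ψ)))
    fixes : All (FixedBy σ) ψ
    fixes = All.tabulate λ { {r , v , ℓ'} c∈ψ → transposeAt-fixes ℓ i i' ℓ' v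
      (λ e → i∉ψ (subst (_∈ cells ψ) e (∈-map⁺ proj₂ c∈ψ)))
      (λ e → i'∉ψ (subst (_∈ cells ψ) e (∈-map⁺ proj₂ c∈ψ))) }
    H∘relabel : ∀ M → H (relabel σ M) ≡ 𝟙 (isPHM M ∧ all (satisfies M) ((r , i , ℓ) ∷ ψ))
    H∘relabel M = cong 𝟙 (cong₂ _∧_ (isPHM-relabel σ M) (cong₂ _∧_
      (trans (cong (λ v → does (σ ℓ ⟨$⟩ʳ M r ℓ ≟ v)) (sym (transposeAt-moves ℓ i i')))
             (does-≟-permute (σ ℓ) (M r ℓ) i))
      (satisfies-relabel σ M ψ fixes)))

  ∑-#satisfying-values : ∀ r ℓ ψ → ∑[ i ∈ allFin n ] #satisfying ((r , i , ℓ) ∷ ψ) ≡ #satisfying ψ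
  ∑-#satisfying-values r ℓ ψ = begin
    ∑[ i ∈ allFin n ] ∑[ M ∈ PHM m k n ] 𝟙 (does (M r ℓ ≟ i) ∧ sat M)
      ≡⟨ ∑-cong (allFin n) (λ i → ∑-cong (PHM m k n) (λ M → 𝟙-∧ (does (M r ℓ ≟ i)) (sat M))) ⟩
    ∑[ i ∈ allFin n ] ∑[ M ∈ PHM m k n ] (δ (M r ℓ) i * 𝟙 (sat M))
      ≡⟨ ∑-comm (allFin n) (PHM m k n) _ ⟩
    ∑[ M ∈ PHM m k n ] ∑[ i ∈ allFin n ] (δ (M r ℓ) i * 𝟙 (sat M))
      ≡⟨ ∑-cong (PHM m k n) (λ M → ∑-δ (M r ℓ) (λ _ → 𝟙 (sat M))) ⟩
    #satisfying ψ ∎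
    where
    open ≡-Reasoning
    sat : Matrix m k n → Bool
    sat M = all (satisfies M) ψ

  #satisfying-extend : ∀ r i ℓ (ψ : List (Constraint m k n)) → (i , ℓ) ∉ cells ψ →
    #satisfying ((r , i , ℓ) ∷ ψ) * (n ∸ length ψ) ≤ #satisfying ψ
  #satisfying-extend r i ℓ ψ i∉ψ = begin
    c * (n ∸ length ψ)                                   ≤⟨ *-monoʳ-≤ c (m≤n+o⇒m∸n≤o n (length ψ) enough-free) ⟩
    c * ∑[ i' ∈ allFin n ] 𝟙 (free i')                   ≡⟨ ∑-*ˡ (allFin n) c _ ⟨
    ∑[ i' ∈ allFin n ] (c * 𝟙 (free i'))                 ≤⟨ ∑-mono (allFin n) swap ⟩
    ∑[ i' ∈ allFin n ] #satisfying ((r , i' , ℓ) ∷ ψ)    ≡⟨ ∑-#satisfying-values r ℓ ψ ⟩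
    #satisfying ψ ∎
    where
    open ≤-Reasoning
    c = #satisfying ((r , i , ℓ) ∷ ψ)
    free : Fin n → Bool
    free i' = not (does ((i' , ℓ) ∈? cells ψ))
    enough-free : n ≤ length ψ + ∑[ i' ∈ allFin n ] 𝟙 (free i')
    enough-free = subst (λ l → n ≤ l + ∑[ i' ∈ allFin n ] 𝟙 (free i')) (length-map proj₂ ψ)
                        (free-values ℓ (cells ψ))
    swap : ∀ i' → c * 𝟙 (free i') ≤ #satisfying ((r , i' , ℓ) ∷ ψ)
    swap i' with (i' , ℓ) ∈? cells ψ
    ... | yes _ = subst (_≤ #satisfying ((r , i' , ℓ) ∷ ψ)) (sym (*-zeroʳ c)) z≤n
    ... | no i'∉ψ = ≤-reflexive (trans (*-identityʳ c) (sym (#satisfying-swap r ℓ ψ i∉ψ i'∉ψ)))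

  #satisfying-distinct : ∀ (ψ : List (Constraint m k n)) → Unique (cells ψ) →
    #satisfying ψ * (n P′ length ψ) ≤ length (PHM m k n)
  #satisfying-distinct [] _ = ≤-reflexive (trans (*-identityʳ (#satisfying [])) (∑-one (PHM m k n)))
  #satisfying-distinct ((r , i , ℓ) ∷ ψ) distinct@(_ ∷ distinct-ψ) = begin
    c * ((n ∸ length ψ) * (n P′ length ψ))  ≡⟨ *-assoc c (n ∸ length ψ) (n P′ length ψ) ⟨
    c * (n ∸ length ψ) * (n P′ length ψ)    ≤⟨ *-monoˡ-≤ (n P′ length ψ) (#satisfying-extend r i ℓ ψ i∉ψ) ⟩
    #satisfying ψ * (n P′ length ψ)        ≤⟨ #satisfying-distinct ψ distinct-ψ ⟩
    length (PHM m k n)                     ∎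
    where
    open ≤-Reasoning
    c = #satisfying ((r , i , ℓ) ∷ ψ)
    i∉ψ = Unique.Unique[x∷xs]⇒x∉xs distinct

-- Labellings

data Label (m : ℕ) : Set where
  unpinned : Label m
  lone     : Fin m → Label m
  anchor   : Fin m → Label m
  follower : ℕ → Label m

module _ {m : ℕ} where

  isLone isAnchor isFollower : Label m → Bool
  isLone (lone _) = true
  isLone _ = false
  isAnchor (anchor _) = true
  isAnchor _ = false
  isFollower (follower _) = true
  isFollower _ = false

  #lone #anchor #follower : List (Label m) → ℕ
  #lone ls = ∑[ l ∈ ls ] 𝟙 (isLone l)
  #anchor ls = ∑[ l ∈ ls ] 𝟙 (isAnchor l)
  #follower ls = ∑[ l ∈ ls ] 𝟙 (isFollower l)

  #pinned : List (Label m) → ℕ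
  #pinned ls = #lone ls + #anchor ls + #follower ls

  anchorAt : List (Label m) → ℕ → Maybe (Fin m)
  anchorAt [] q = nothing
  anchorAt (_ ∷ L) (suc q) = anchorAt L q
  anchorAt (anchor r ∷ L) zero = just r
  anchorAt (_ ∷ L) zero = nothing

  pinnedRow : List (Label m) → Label m → Maybe (Fin m)
  pinnedRow L unpinned = nothing
  pinnedRow L (lone r) = just r
  pinnedRow L (anchor r) = just r
  pinnedRow L (follower q) = anchorAt L q

  anchorAt-index : ∀ (f : A → Label m) {x xs} (x∈xs : x ∈ xs) {r} →
    f x ≡ anchor r → anchorAt (map f xs) (toℕ (index x∈xs)) ≡ just r
  anchorAt-index f (here refl) fx≡anchor rewrite fx≡anchor = refl
  anchorAt-index f (there x∈xs) fx≡anchor = anchorAt-index f x∈xs fx≡anchor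

  Resolved : List (Label m) → Label m → Set
  Resolved L (follower q) = Is-just (anchorAt L q)
  Resolved L _ = ⊤

  module _ {k n : ℕ} where

    -- The first argument is the whole labelling, in which followers look up their anchors;
    -- the second one runs through it alongside the points.
    constraints : List (Label m) → List (Label m) → List (Point n k) → List (Constraint m k n)
    constraints L (l ∷ ls) (p ∷ ps) = Maybe.map (_, p) (pinnedRow L l) ?∷ constraints L ls ps
    constraints L _ _ = []

    constraints-All : ∀ {P : Point n k → Set} L ls {ps} → All P ps → All P (cells (constraints L ls ps))
    constraints-All L [] _ = []
    constraints-All L (l ∷ ls) [] = []
    constraints-All L (l ∷ ls) (Pp ∷ Pps) with pinnedRow L l
    ... | nothing = constraints-All L ls Pps
    ... | just r = Pp ∷ constraints-All L ls Pps

    constraints-distinct : ∀ L ls {ps} → Unique ps → Unique (cells (constraints L ls ps))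
    constraints-distinct L [] _ = []
    constraints-distinct L (l ∷ ls) [] = []
    constraints-distinct L (l ∷ ls) (p∉ps ∷ distinct) with pinnedRow L l
    ... | nothing = constraints-distinct L ls distinct
    ... | just r = constraints-All L ls p∉ps ∷ constraints-distinct L ls distinct

    length-constraints : ∀ L ls ps → length ls ≡ length ps → All (Resolved L) ls →
      length (constraints L ls ps) ≡ #pinned ls
    length-constraints L [] [] _ [] = refl
    length-constraints L (unpinned ∷ ls) (p ∷ ps) e (_ ∷ rs) = length-constraints L ls ps (suc-injective e) rs
    length-constraints L (lone r ∷ ls) (p ∷ ps) e (_ ∷ rs) = cong suc (length-constraints L ls ps (suc-injective e) rs)
    length-constraints L (anchor r ∷ ls) (p ∷ ps) e (_ ∷ rs) =
      trans (cong suc (length-constraints L ls ps (suc-injective e) rs))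
            (cong (_+ #follower ls) (sym (+-suc (#lone ls) (#anchor ls))))
    length-constraints L (follower q ∷ ls) (p ∷ ps) e (resolved ∷ rs) with anchorAt L q
    ... | just r = trans (cong suc (length-constraints L ls ps (suc-injective e) rs))
                         (sym (+-suc (#lone ls + #anchor ls) (#follower ls)))

    constraints-satisfied : ∀ (M : Matrix m k n) L (f : Point n k → Label m) ps →
      (∀ {p} → p ∈ ps → ∀ {r} → pinnedRow L (f p) ≡ just r → M r (proj₂ p) ≡ proj₁ p) →
      T (all (satisfies M) (constraints L (map f ps) ps))
    constraints-satisfied M L f [] sound = tt
    constraints-satisfied M L f ((i , ℓ) ∷ ps) sound with pinnedRow L (f (i , ℓ)) in pinned
    ... | nothing = constraints-satisfied M L f ps (sound ∘ there)
    ... | just r rewrite dec-true (M r ℓ ≟ i) (sound (here refl) pinned) =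
      constraints-satisfied M L f ps (sound ∘ there)

module _ {m k n : ℕ} (ps : List (Point n k)) where

  -- The length test says that the labelling pins exactly t cells; it fails when a follower has
  -- no anchor at its position.
  realises : ℕ → List (Label m) → Matrix m k n → Bool
  realises t L M = does (length (constraints L L ps) ≟ℕ t) ∧ all (satisfies M) (constraints L L ps)

  #realising-P′ : Unique ps → ∀ t L → #PHM (realises t L) * (n P′ t) ≤ length (PHM m k n)
  #realising-P′ distinct t L = by-length (length ψ ≟ℕ t)
    where
    ψ = constraints L L ps
    by-length : (d : Dec (length ψ ≡ t)) →
      #PHM (λ M → does d ∧ all (satisfies M) ψ) * (n P′ t) ≤ length (PHM m k n)
    by-length (yes refl) = #satisfying-distinct ψ (constraints-distinct L L distinct)
    by-length (no _) = subst (λ c → c * (n P′ t) ≤ length (PHM m k n)) (sym (∑-zero (PHM m k n))) z≤n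

  realises-intro : ∀ t L (M : Matrix m k n) → length (constraints L L ps) ≡ t →
    T (all (satisfies M) (constraints L L ps)) → T (realises t L M)
  realises-intro t L M length≡t satisfied rewrite dec-true (length (constraints L L ps) ≟ℕ t) length≡t = satisfied

labels : ∀ m → ℕ → List (Label m)
labels m u = unpinned ∷ map lone (allFin m) ++ map anchor (allFin m) ++ map follower (upTo u)

module _ {m : ℕ} where

  hasCounts : List (Label m) → ℕ → ℕ → ℕ → Bool
  hasCounts [] zero zero zero = true
  hasCounts [] _ _ _ = false
  hasCounts (unpinned ∷ L) a b c = hasCounts L a b c
  hasCounts (lone _ ∷ L) zero b c = false
  hasCounts (lone _ ∷ L) (suc a) b c = hasCounts L a b c
  hasCounts (anchor _ ∷ L) a zero c = false
  hasCounts (anchor _ ∷ L) a (suc b) c = hasCounts L a b c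
  hasCounts (follower _ ∷ L) a b zero = false
  hasCounts (follower _ ∷ L) a b (suc c) = hasCounts L a b c

  hasCounts-self : ∀ L → hasCounts L (#lone L) (#anchor L) (#follower L) ≡ true
  hasCounts-self [] = refl
  hasCounts-self (unpinned ∷ L) = hasCounts-self L
  hasCounts-self (lone _ ∷ L) = hasCounts-self L
  hasCounts-self (anchor _ ∷ L) = hasCounts-self L
  hasCounts-self (follower _ ∷ L) = hasCounts-self L

  InRange : ℕ → Label m → Set
  InRange u (follower q) = q < u
  InRange u _ = ⊤

  ∈-labels : ∀ u l → InRange u l → l ∈ labels m u
  ∈-labels u unpinned _ = here refl
  ∈-labels u (lone r) _ = there (∈-++⁺ˡ (∈-map⁺ lone (∈-allFin r)))
  ∈-labels u (anchor r) _ = there (∈-++⁺ʳ (map lone (allFin m)) (∈-++⁺ˡ (∈-map⁺ anchor (∈-allFin r))))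
  ∈-labels u (follower q) q<u =
    there (∈-++⁺ʳ (map lone (allFin m)) (∈-++⁺ʳ (map anchor (allFin m)) (∈-map⁺ follower (∈-upTo⁺ q<u))))

  #pinned-≤-length : ∀ (L : List (Label m)) → #pinned L ≤ length L
  #pinned-≤-length L = begin
    #lone L + #anchor L + #follower L
      ≡⟨ cong (_+ #follower L) (∑-distrib-+ L _ _) ⟨
    ∑[ l ∈ L ] (𝟙 (isLone l) + 𝟙 (isAnchor l)) + #follower L
      ≡⟨ ∑-distrib-+ L _ _ ⟨
    ∑[ l ∈ L ] (𝟙 (isLone l) + 𝟙 (isAnchor l) + 𝟙 (isFollower l))
      ≤⟨ ∑-mono L at-most-one ⟩
    ∑[ l ∈ L ] 1
      ≡⟨ ∑-one L ⟩
    length L ∎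
    where
    open ≤-Reasoning
    at-most-one : ∀ l → 𝟙 (isLone l) + 𝟙 (isAnchor l) + 𝟙 (isFollower l) ≤ 1
    at-most-one unpinned = z≤n
    at-most-one (lone _) = ≤-refl
    at-most-one (anchor _) = ≤-refl
    at-most-one (follower _) = ≤-refl

-- The labelling of a matrix

module _ {n k : ℕ} (U : SubsetNK n k) where

  allPoints : List (Point n k)
  allPoints = concatMap (λ i → map (λ ℓ → (i , ℓ)) (allFin k)) (allFin n)

  pointsOf : List (Point n k)
  pointsOf = filter (λ p → U (proj₁ p) (proj₂ p) Bool.≟ true) allPoints

  ∑-pointsOf : ∀ (f : Point n k → ℕ) →
    ∑ pointsOf f ≡ ∑[ i ∈ allFin n ] ∑[ ℓ ∈ allFin k ] (𝟙 (U i ℓ) * f (i , ℓ))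
  ∑-pointsOf f = trans (∑-filter (λ p → U (proj₁ p) (proj₂ p)) allPoints f)
    (trans (∑-concatMap _ (allFin n) _) (∑-cong (allFin n) (λ i → ∑-map (i ,_) (allFin k) _)))

  ∈-pointsOf : ∀ {i ℓ} → U i ℓ ≡ true → (i , ℓ) ∈ pointsOf
  ∈-pointsOf {i} {ℓ} Uiℓ = ∈-filter⁺ (λ p → U (proj₁ p) (proj₂ p) Bool.≟ true)
    (∈-concatMap⁺ (λ i → map (i ,_) (allFin k))
      (Any.map (λ { refl → ∈-map⁺ (i ,_) (∈-allFin ℓ) }) (∈-allFin i))) Uiℓ

  ∈-pointsOf⁻ : ∀ {p} → p ∈ pointsOf → U (proj₁ p) (proj₂ p) ≡ true
  ∈-pointsOf⁻ p∈ = proj₂ (∈-filter⁻ (λ p → U (proj₁ p) (proj₂ p) Bool.≟ true) {xs = allPoints} p∈)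

  pointsOf-unique : Unique pointsOf
  pointsOf-unique = Unique.filter⁺ _ (subst Unique (sym (concatMap≡cartesianProduct (allFin n)))
    (Unique.cartesianProduct⁺ (Unique.allFin⁺ n) (Unique.allFin⁺ k)))
    where
    concatMap≡cartesianProduct : ∀ is →
      concatMap (λ i → map (λ ℓ → (i , ℓ)) (allFin k)) is ≡ cartesianProduct is (allFin k)
    concatMap≡cartesianProduct [] = refl
    concatMap≡cartesianProduct (i ∷ is) = cong (map (i ,_) (allFin k) ++_) (concatMap≡cartesianProduct is)

module Labelling {m k n : ℕ} (U : SubsetNK n k) (M : Matrix m k n) (phm : T (isPHM M)) where

  meet : Fin m → ℕ
  meet = edgeMeet U M

  meet≡∑ : ∀ j → meet j ≡ ∑[ ℓ ∈ allFin k ] 𝟙 (U (M j ℓ) ℓ)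
  meet≡∑ j = length-filter≡∑ (λ ℓ → U (M j ℓ) ℓ) (allFin k)

  ∑-meet : ∀ j c → ∑[ ℓ ∈ allFin k ] (𝟙 (U (M j ℓ) ℓ) * c) ≡ meet j * c
  ∑-meet j c = trans (∑-*ʳ (allFin k) _ c) (cong (_* c) (sym (meet≡∑ j)))

  row? : ∀ i ℓ → Dec (∃ λ j → M j ℓ ≡ i)
  row? i ℓ = any? (λ j → M j ℓ ≟ i)

  onEdge : Point n k → (Fin m → ℕ) → ℕ
  onEdge (i , ℓ) h with row? i ℓ
  ... | yes (j , _) = h j
  ... | no _ = 0

  onEdge≡∑ : ∀ i ℓ h → onEdge (i , ℓ) h ≡ ∑[ j ∈ allFin m ] (δ (M j ℓ) i * h j)
  onEdge≡∑ i ℓ h with row? i ℓ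
  ... | no ∄j = sym (trans (∑-cong (allFin m) (λ j → cong (λ b → 𝟙 b * h j) (dec-false (M j ℓ ≟ i) (∄j ∘ (j ,_)))))
                           (∑-zero (allFin m)))
  ... | yes (j₀ , Mj₀ℓ≡i) = sym (trans (∑-cong (allFin m) (λ j → cong (_* h j) (on-j₀ j))) (∑-δ j₀ h))
    where
    on-j₀ : ∀ j → δ (M j ℓ) i ≡ δ j₀ j
    on-j₀ j = cong 𝟙 (does-⇔ (mk⇔ (λ e → phm-column-injective phm ℓ (trans Mj₀ℓ≡i (sym e)))
                                  (λ { refl → Mj₀ℓ≡i })) (M j ℓ ≟ i) (j₀ ≟ j))

  ∑-onEdge : ∀ (h : Fin m → Fin k → ℕ) →
    ∑[ p ∈ pointsOf U ] onEdge p (λ j → h j (proj₂ p)) ≡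
    ∑[ j ∈ allFin m ] ∑[ ℓ ∈ allFin k ] (𝟙 (U (M j ℓ) ℓ) * h j ℓ)
  ∑-onEdge h = begin
    ∑[ p ∈ pointsOf U ] onEdge p (λ j → h j (proj₂ p))
      ≡⟨ ∑-pointsOf U _ ⟩
    ∑[ i ∈ allFin n ] ∑[ ℓ ∈ allFin k ] (𝟙 (U i ℓ) * onEdge (i , ℓ) (λ j → h j ℓ))
      ≡⟨ ∑-cong (allFin n) (λ i → ∑-cong (allFin k) (λ ℓ → trans (cong (𝟙 (U i ℓ) *_) (onEdge≡∑ i ℓ _))
           (trans (sym (∑-*ˡ (allFin m) (𝟙 (U i ℓ)) (λ j → δ (M j ℓ) i * h j ℓ)))
             (∑-cong (allFin m) (λ j → x∙yz≈y∙xz (𝟙 (U i ℓ)) (δ (M j ℓ) i) (h j ℓ)))))) ⟩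
    ∑[ i ∈ allFin n ] ∑[ ℓ ∈ allFin k ] ∑[ j ∈ allFin m ] (δ (M j ℓ) i * (𝟙 (U i ℓ) * h j ℓ))
      ≡⟨ ∑-comm (allFin n) (allFin k) _ ⟩
    ∑[ ℓ ∈ allFin k ] ∑[ i ∈ allFin n ] ∑[ j ∈ allFin m ] (δ (M j ℓ) i * (𝟙 (U i ℓ) * h j ℓ))
      ≡⟨ ∑-cong (allFin k) (λ ℓ → ∑-comm (allFin n) (allFin m) _) ⟩
    ∑[ ℓ ∈ allFin k ] ∑[ j ∈ allFin m ] ∑[ i ∈ allFin n ] (δ (M j ℓ) i * (𝟙 (U i ℓ) * h j ℓ))
      ≡⟨ ∑-cong (allFin k) (λ ℓ → ∑-cong (allFin m) (λ j → ∑-δ (M j ℓ) (λ i → 𝟙 (U i ℓ) * h j ℓ))) ⟩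
    ∑[ ℓ ∈ allFin k ] ∑[ j ∈ allFin m ] (𝟙 (U (M j ℓ) ℓ) * h j ℓ)
      ≡⟨ ∑-comm (allFin k) (allFin m) _ ⟩
    ∑[ j ∈ allFin m ] ∑[ ℓ ∈ allFin k ] (𝟙 (U (M j ℓ) ℓ) * h j ℓ) ∎
    where open ≡-Reasoning

  anchorColumn? : ∀ j → Dec (∃ λ ℓ → U (M j ℓ) ℓ ≡ true)
  anchorColumn? j = any? (λ ℓ → U (M j ℓ) ℓ Bool.≟ true)

  isAnchorColumn : Fin m → Fin k → Bool
  isAnchorColumn j ℓ with anchorColumn? j
  ... | yes (ℓ₀ , _) = does (ℓ₀ ≟ ℓ)
  ... | no _ = false

  anchorIndex : Fin m → ℕ
  anchorIndex j with anchorColumn? j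
  ... | yes (ℓ₀ , onU) = toℕ (index (∈-pointsOf U onU))
  ... | no _ = 0

  -- The label of a point of U in column ℓ of e_j, given x = |e_j ∩ U| and whether ℓ is the anchor
  -- column of e_j.  With multi = false the points of edges in D stay unpinned.
  classify : Bool → ℕ → Bool → Fin m → ℕ → Label m
  classify _ 1 _ j q = lone j
  classify true (suc (suc _)) true j q = anchor j
  classify true (suc (suc _)) false j q = follower q
  classify _ _ _ _ _ = unpinned

  edgeLabel : Bool → Fin m → Fin k → Label m
  edgeLabel multi j ℓ = classify multi (meet j) (isAnchorColumn j ℓ) j (anchorIndex j)

  label : Bool → Point n k → Label m
  label multi (i , ℓ) with row? i ℓ
  ... | yes (j , _) = edgeLabel multi j ℓ
  ... | no _ = unpinned

  configuration : Bool → List (Label m)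
  configuration multi = map (label multi) (pointsOf U)

  ∑-configuration : ∀ multi (s : Label m → ℕ) → s unpinned ≡ 0 →
    ∑ (configuration multi) s ≡
    ∑[ j ∈ allFin m ] ∑[ ℓ ∈ allFin k ] (𝟙 (U (M j ℓ) ℓ) * s (edgeLabel multi j ℓ))
  ∑-configuration multi s s-unpinned =
    trans (∑-map (label multi) (pointsOf U) s) (trans (∑-cong (pointsOf U) on-edge) (∑-onEdge _))
    where
    on-edge : ∀ p → s (label multi p) ≡ onEdge p (λ j → s (edgeLabel multi j (proj₂ p)))
    on-edge (i , ℓ) with row? i ℓ
    ... | yes _ = refl
    ... | no _ = s-unpinned

  private
    classify-lone : ∀ multi x b j q → 𝟙 (isLone (classify multi x b j q)) ≡ 𝟙 (isOne x)
    classify-lone multi zero b j q = refl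
    classify-lone multi 1 b j q = refl
    classify-lone true (suc (suc x)) true j q = refl
    classify-lone true (suc (suc x)) false j q = refl
    classify-lone false (suc (suc x)) b j q = refl

    classify-multi : ∀ x b j q →
      𝟙 (isAnchor (classify true x b j q)) + 𝟙 (isFollower (classify true x b j q)) ≡ 𝟙 (atLeastTwo x)
    classify-multi zero b j q = refl
    classify-multi 1 b j q = refl
    classify-multi (suc (suc x)) true j q = refl
    classify-multi (suc (suc x)) false j q = refl

    classify-anchor : ∀ x b j q → 𝟙 (isAnchor (classify true x b j q)) ≡ 𝟙 (atLeastTwo x) * 𝟙 b
    classify-anchor zero b j q = refl
    classify-anchor 1 b j q = refl
    classify-anchor (suc (suc x)) true j q = refl
    classify-anchor (suc (suc x)) false j q = refl

    classify-single : ∀ x b j q →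
      𝟙 (isAnchor (classify false x b j q)) + 𝟙 (isFollower (classify false x b j q)) ≡ 0
    classify-single zero b j q = refl
    classify-single 1 b j q = refl
    classify-single (suc (suc x)) b j q = refl

    x*𝟙[x≡1] : ∀ x → x * 𝟙 (isOne x) ≡ 𝟙 (isOne x)
    x*𝟙[x≡1] zero = refl
    x*𝟙[x≡1] 1 = refl
    x*𝟙[x≡1] (suc (suc x)) = *-zeroʳ (suc (suc x))

    2*𝟙[x≥2]≤x*𝟙[x≥2] : ∀ x → 2 * 𝟙 (atLeastTwo x) ≤ x * 𝟙 (atLeastTwo x)
    2*𝟙[x≥2]≤x*𝟙[x≥2] zero = z≤n
    2*𝟙[x≥2]≤x*𝟙[x≥2] 1 = z≤n
    2*𝟙[x≥2]≤x*𝟙[x≥2] (suc (suc x)) = *-monoˡ-≤ 1 (s≤s (s≤s (z≤n {x})))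

  ∑-configuration-by-meet : ∀ multi (s : Label m → ℕ) (g : ℕ → ℕ) → s unpinned ≡ 0 →
    (∀ x b j q → s (classify multi x b j q) ≡ g x) →
    ∑ (configuration multi) s ≡ ∑[ j ∈ allFin m ] (meet j * g (meet j))
  ∑-configuration-by-meet multi s g s-unpinned s≡g = trans (∑-configuration multi s s-unpinned)
    (∑-cong (allFin m) (λ j → trans (∑-cong (allFin k) (λ ℓ → cong (𝟙 (U (M j ℓ) ℓ) *_) (s≡g (meet j) _ j _)))
                                    (∑-meet j (g (meet j)))))

  #lone-configuration : ∀ multi → #lone (configuration multi) ≡ kappa U M
  #lone-configuration multi = begin
    #lone (configuration multi)                  ≡⟨ ∑-configuration-by-meet multi _ _ refl (classify-lone multi) ⟩
    ∑[ j ∈ allFin m ] (meet j * 𝟙 (isOne (meet j))) ≡⟨ ∑-cong (allFin m) (λ j → x*𝟙[x≡1] (meet j)) ⟩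
    ∑[ j ∈ allFin m ] 𝟙 (isOne (meet j))         ≡⟨ length-filter≡∑ (inK U M) (allFin m) ⟨
    kappa U M                                    ∎
    where open ≡-Reasoning

  multiSum : ℕ
  multiSum = ∑[ j ∈ allFin m ] (meet j * 𝟙 (atLeastTwo (meet j)))

  #anchor+#follower-configuration : #anchor (configuration true) + #follower (configuration true) ≡ multiSum
  #anchor+#follower-configuration = trans (sym (∑-distrib-+ (configuration true) _ _))
    (∑-configuration-by-meet true (λ l → 𝟙 (isAnchor l) + 𝟙 (isFollower l)) (𝟙 ∘ atLeastTwo) refl classify-multi)

  #anchor+#follower-single : #anchor (configuration false) + #follower (configuration false) ≡ 0
  #anchor+#follower-single = trans (sym (∑-distrib-+ (configuration false) _ _))
    (trans (∑-configuration-by-meet false (λ l → 𝟙 (isAnchor l) + 𝟙 (isFollower l)) (λ _ → 0) refl classify-single)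
           (trans (∑-cong (allFin m) (λ j → *-zeroʳ (meet j))) (∑-zero (allFin m))))

  onEdge-≤ : ∀ p {h c} → (∀ j → h j ≤ c) → onEdge p h ≤ c
  onEdge-≤ (i , ℓ) h≤c with row? i ℓ
  ... | yes (j , _) = h≤c j
  ... | no _ = z≤n

  eta≡multiSum : eta U M ≡ multiSum
  eta≡multiSum = begin
    eta U M
      ≡⟨ length-filter≡∑ (λ p → U (proj₁ p) (proj₂ p) ∧ inUnionD U M (proj₁ p) (proj₂ p)) (allPoints U) ⟩
    ∑[ p ∈ allPoints U ] 𝟙 (U (proj₁ p) (proj₂ p) ∧ inUnionD U M (proj₁ p) (proj₂ p))
      ≡⟨ ∑-cong (allPoints U) (λ p → 𝟙-∧ (U (proj₁ p) (proj₂ p)) _) ⟩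
    ∑[ p ∈ allPoints U ] (𝟙 (U (proj₁ p) (proj₂ p)) * 𝟙 (inUnionD U M (proj₁ p) (proj₂ p)))
      ≡⟨ ∑-filter (λ p → U (proj₁ p) (proj₂ p)) (allPoints U) _ ⟨
    ∑[ p ∈ pointsOf U ] 𝟙 (inUnionD U M (proj₁ p) (proj₂ p))
      ≡⟨ ∑-cong (pointsOf U) inUnion≡onEdge ⟩
    ∑[ p ∈ pointsOf U ] onEdge p (λ j → 𝟙 (atLeastTwo (meet j)))
      ≡⟨ ∑-onEdge (λ j _ → 𝟙 (atLeastTwo (meet j))) ⟩
    ∑[ j ∈ allFin m ] ∑[ ℓ ∈ allFin k ] (𝟙 (U (M j ℓ) ℓ) * 𝟙 (atLeastTwo (meet j)))
      ≡⟨ ∑-cong (allFin m) (λ j → ∑-meet j _) ⟩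
    multiSum ∎
    where
    open ≡-Reasoning
    inUnion≡onEdge : ∀ p → 𝟙 (inUnionD U M (proj₁ p) (proj₂ p)) ≡ onEdge p (λ j → 𝟙 (atLeastTwo (meet j)))
    inUnion≡onEdge (i , ℓ) =
      trans (𝟙-any _ (allFin m) (≤-trans (≤-reflexive ∑≡onEdge) (onEdge-≤ (i , ℓ) (λ j → 𝟙≤1 _)))) ∑≡onEdge
      where
      ∑≡onEdge : ∑[ j ∈ allFin m ] 𝟙 (inD U M j ∧ ⌊ M j ℓ ≟ i ⌋) ≡
                 onEdge (i , ℓ) (λ j → 𝟙 (atLeastTwo (meet j)))
      ∑≡onEdge = trans (∑-cong (allFin m) (λ j → trans (𝟙-∧ (inD U M j) _)
                   (trans (*-comm (𝟙 (inD U M j)) _) (cong (λ b → 𝟙 b * 𝟙 (inD U M j)) (isYes≗does (M j ℓ ≟ i))))))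
                   (sym (onEdge≡∑ i ℓ _))

  multiEdges : ℕ
  multiEdges = ∑[ j ∈ allFin m ] 𝟙 (atLeastTwo (meet j))

  2*multiEdges≤multiSum : 2 * multiEdges ≤ multiSum
  2*multiEdges≤multiSum = begin
    2 * multiEdges                                 ≡⟨ ∑-*ˡ (allFin m) 2 _ ⟨
    ∑[ j ∈ allFin m ] (2 * 𝟙 (atLeastTwo (meet j))) ≤⟨ ∑-mono (allFin m) (λ j → 2*𝟙[x≥2]≤x*𝟙[x≥2] (meet j)) ⟩
    multiSum                                       ∎
    where open ≤-Reasoning

  #anchor≤multiEdges : #anchor (configuration true) ≤ multiEdges
  #anchor≤multiEdges = begin
    #anchor (configuration true)
      ≡⟨ ∑-configuration true (𝟙 ∘ isAnchor) refl ⟩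
    ∑[ j ∈ allFin m ] ∑[ ℓ ∈ allFin k ] (𝟙 (U (M j ℓ) ℓ) * 𝟙 (isAnchor (edgeLabel true j ℓ)))
      ≤⟨ ∑-mono (allFin m) (λ j → ∑-mono (allFin k) (λ ℓ → ≤-trans (*-monoˡ-≤ _ (𝟙≤1 (U (M j ℓ) ℓ)))
           (≤-reflexive (trans (+-identityʳ _) (classify-anchor (meet j) _ j _))))) ⟩
    ∑[ j ∈ allFin m ] ∑[ ℓ ∈ allFin k ] (𝟙 (atLeastTwo (meet j)) * 𝟙 (isAnchorColumn j ℓ))
      ≡⟨ ∑-cong (allFin m) (λ j → ∑-*ˡ (allFin k) (𝟙 (atLeastTwo (meet j))) (𝟙 ∘ isAnchorColumn j)) ⟩
    ∑[ j ∈ allFin m ] (𝟙 (atLeastTwo (meet j)) * ∑[ ℓ ∈ allFin k ] 𝟙 (isAnchorColumn j ℓ))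
      ≤⟨ ∑-mono (allFin m) (λ j → ≤-trans (*-monoʳ-≤ (𝟙 (atLeastTwo (meet j))) (one-anchor-column j))
           (≤-reflexive (*-identityʳ (𝟙 (atLeastTwo (meet j)))))) ⟩
    multiEdges ∎
    where
    open ≤-Reasoning
    one-anchor-column : ∀ j → ∑[ ℓ ∈ allFin k ] 𝟙 (isAnchorColumn j ℓ) ≤ 1
    one-anchor-column j with anchorColumn? j
    ... | yes (ℓ₀ , _) = ≤-reflexive (∑-δ-one ℓ₀)
    ... | no _ = ≤-trans (≤-reflexive (∑-zero (allFin k))) z≤n

  private
    classify-pins : ∀ {L : List (Label m)} {u} multi x b j q →
      (T (multi ∧ atLeastTwo x) → anchorAt L q ≡ just j × q < u) →
      Resolved L (classify multi x b j q) × InRange u (classify multi x b j q) ×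
      (∀ {r} → pinnedRow L (classify multi x b j q) ≡ just r → r ≡ j)
    classify-pins multi zero b j q _ = tt , tt , λ ()
    classify-pins multi 1 b j q _ = tt , tt , λ { refl → refl }
    classify-pins true (suc (suc x)) true j q _ = tt , tt , λ { refl → refl }
    classify-pins true (suc (suc x)) false j q located with located tt
    ... | anchorAt≡j , q<u =
      subst Is-just (sym anchorAt≡j) (just tt) , q<u ,
      λ anchorAt≡r → just-injective (trans (sym anchorAt≡r) anchorAt≡j)
    classify-pins false (suc (suc x)) b j q _ = tt , tt , λ ()

    classify-anchor-column : ∀ x j q → T (atLeastTwo x) → classify true x true j q ≡ anchor j
    classify-anchor-column (suc (suc x)) j q _ = refl

  label-at-anchor : ∀ {j ℓ₀ onU} → anchorColumn? j ≡ yes (ℓ₀ , onU) → T (atLeastTwo (meet j)) →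
    label true (M j ℓ₀ , ℓ₀) ≡ anchor j
  label-at-anchor {j} {ℓ₀} anchor≡ e∈D with row? (M j ℓ₀) ℓ₀
  ... | no ∄j = ⊥-elim (∄j (j , refl))
  ... | yes (j' , Mj'ℓ₀≡) with phm-column-injective phm ℓ₀ {j'} {j} Mj'ℓ₀≡
  ... | refl rewrite anchor≡ | dec-true (ℓ₀ ≟ ℓ₀) refl = classify-anchor-column (meet j') j' _ e∈D

  anchor-located : ∀ multi {j ℓ₀ onU} → anchorColumn? j ≡ yes (ℓ₀ , onU) → T (multi ∧ atLeastTwo (meet j)) →
    anchorAt (configuration multi) (toℕ (index (∈-pointsOf U onU))) ≡ just j ×
    toℕ (index (∈-pointsOf U onU)) < length (pointsOf U)
  anchor-located true anchor≡ e∈D =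
    anchorAt-index (label true) (∈-pointsOf U _) (label-at-anchor anchor≡ e∈D) , toℕ<n _

  label-sound : ∀ multi {p} → p ∈ pointsOf U →
    Resolved (configuration multi) (label multi p) × InRange (length (pointsOf U)) (label multi p) ×
    (∀ {r} → pinnedRow (configuration multi) (label multi p) ≡ just r → M r (proj₂ p) ≡ proj₁ p)
  label-sound multi {i , ℓ} p∈ with row? i ℓ
  ... | no _ = tt , tt , λ ()
  ... | yes (j , Mjℓ≡i) with anchorColumn? j in anchor≡
  ...   | no ∄ℓ₀ = ⊥-elim (∄ℓ₀ (ℓ , trans (cong (λ v → U v ℓ) Mjℓ≡i) (∈-pointsOf⁻ U p∈)))
  ...   | yes (ℓ₀ , onU) with classify-pins multi (meet j) (does (ℓ₀ ≟ ℓ)) j _ (anchor-located multi anchor≡)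
  ...     | resolved , inRange , pins =
    resolved , inRange , λ pinned → subst (λ r → M r ℓ ≡ i) (sym (pins pinned)) Mjℓ≡i

  configuration-realises : ∀ multi → T (realises (pointsOf U) (#pinned (configuration multi)) (configuration multi) M)
  configuration-realises multi = realises-intro (pointsOf U) _ L M
    (length-constraints L L (pointsOf U) (length-map (label multi) (pointsOf U))
      (All.map⁺ (All.tabulate (λ p∈ → proj₁ (label-sound multi p∈)))))
    (constraints-satisfied M L (label multi) (pointsOf U) (λ p∈ → proj₂ (proj₂ (label-sound multi p∈))))
    where L = configuration multi

  configuration-labels : ∀ multi → All (_∈ labels m (length (pointsOf U))) (configuration multi)
  configuration-labels multi =
    All.map⁺ (All.tabulate (λ p∈ → ∈-labels _ _ (proj₁ (proj₂ (label-sound multi p∈)))))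

-- Exponentiation on ℕ is opened only inside this module: the _^_ of the theorem is the one on ℚ
-- from Defs.

module CountingBound where

  open import Data.Nat using (_^_)
  open import Data.Nat.Tactic.RingSolver using (solve-∀)
  open import Algebra.Properties.CommutativeSemigroup *-commutativeSemigroup using () renaming (interchange to *-interchange)

  ^-≤-2^*P′ : ∀ n t → 2 * t ≤ n → n ^ t ≤ 2 ^ t * (n P′ t)
  ^-≤-2^*P′ n zero _ = ≤-refl
  ^-≤-2^*P′ n (suc t) 2t+2≤n = begin
    n * n ^ t                                ≤⟨ *-mono-≤ n≤2[n∸t] (^-≤-2^*P′ n t 2t≤n) ⟩
    (2 * (n ∸ t)) * (2 ^ t * (n P′ t))       ≡⟨ *-interchange 2 (n ∸ t) (2 ^ t) (n P′ t) ⟩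
    2 * 2 ^ t * ((n ∸ t) * (n P′ t))         ∎
    where
    open ≤-Reasoning
    2t≤n : 2 * t ≤ n
    2t≤n = ≤-trans (*-monoʳ-≤ 2 (n≤1+n t)) 2t+2≤n
    t+t≤n : t + t ≤ n
    t+t≤n = subst (_≤ n) (cong (t +_) (+-identityʳ t)) 2t≤n
    n≤2[n∸t] : n ≤ 2 * (n ∸ t)
    n≤2[n∸t] = begin
      n                   ≤⟨ m≤n+m∸n n t ⟩
      t + (n ∸ t)         ≤⟨ +-monoˡ-≤ (n ∸ t) (m+n≤o⇒m≤o∸n t t+t≤n) ⟩
      (n ∸ t) + (n ∸ t)   ≡⟨ cong ((n ∸ t) +_) (+-identityʳ (n ∸ t)) ⟨
      2 * (n ∸ t)         ∎

  module _ {m k n : ℕ} (ps : List (Point n k)) where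

    #realising-^ : Unique ps → ∀ t L → 2 * t ≤ n → #PHM (realises ps t L) * n ^ t ≤ 2 ^ t * length (PHM m k n)
    #realising-^ distinct t L 2t≤n = begin
      c * n ^ t                   ≤⟨ *-monoʳ-≤ c (^-≤-2^*P′ n t 2t≤n) ⟩
      c * (2 ^ t * (n P′ t))      ≡⟨ x∙yz≈y∙xz c (2 ^ t) (n P′ t) ⟩
      2 ^ t * (c * (n P′ t))      ≤⟨ *-monoʳ-≤ (2 ^ t) (#realising-P′ {m} ps distinct t L) ⟩
      2 ^ t * length (PHM m k n)  ∎
      where
      open ≤-Reasoning
      c = #PHM (realises ps t L)

  module _ {m : ℕ} where

    #configurations : ℕ → ℕ → ℕ → ℕ → ℕ → ℕ
    #configurations u t a b c = ∑[ L ∈ allLists t (labels m u) ] 𝟙 (hasCounts L a b c)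

    configurationBound : ℕ → ℕ → ℕ → ℕ → ℕ → ℕ
    configurationBound u t a b c = 4 ^ t * (m ^ (a + b) * u ^ c)

    private
      *-pull-middle : ∀ w x y z → w * (x * (y * z)) ≡ x * (w * y * z)
      *-pull-middle = solve-∀

      *-pull-last : ∀ w x y z → w * (x * (y * z)) ≡ x * (y * (w * z))
      *-pull-last = solve-∀

      Bounded : ℕ → ℕ → Set
      Bounded u t = ∀ a b c → #configurations u t a b c ≤ configurationBound u t a b c

      nothing-≤ : ∀ u t (xs : List A) (l : A → Label m) {a b c y} →
        (∀ x L → hasCounts (l x ∷ L) a b c ≡ false) →
        ∑[ x ∈ xs ] ∑[ L ∈ allLists t (labels m u) ] 𝟙 (hasCounts (l x ∷ L) a b c) ≤ y
      nothing-≤ u t xs l none = ≤-trans (≤-reflexive (trans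
        (∑-cong xs (λ x → trans (∑-cong (allLists t (labels m u)) (λ L → cong 𝟙 (none x L)))
                                (∑-zero (allLists t (labels m u)))))
        (∑-zero xs))) z≤n

      lone-≤ : ∀ u t → Bounded u t → ∀ a b c →
        ∑[ r ∈ allFin m ] ∑[ L ∈ allLists t (labels m u) ] 𝟙 (hasCounts (lone r ∷ L) a b c) ≤
        configurationBound u t a b c
      lone-≤ u t ih zero b c = nothing-≤ u t (allFin m) lone {zero} {b} {c} (λ _ _ → refl)
      lone-≤ u t ih (suc a) b c = begin
        ∑[ r ∈ allFin m ] #configurations u t a b c      ≤⟨ ∑-≤-length* (allFin m) (λ _ → ih a b c) ⟩
        length (allFin m) * configurationBound u t a b c ≡⟨ cong (_* configurationBound u t a b c) (length-allFin m) ⟩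
        m * (4 ^ t * (m ^ (a + b) * u ^ c))              ≡⟨ *-pull-middle m (4 ^ t) (m ^ (a + b)) (u ^ c) ⟩
        4 ^ t * (m ^ (suc a + b) * u ^ c)                ∎
        where open ≤-Reasoning

      anchor-≤ : ∀ u t → Bounded u t → ∀ a b c →
        ∑[ r ∈ allFin m ] ∑[ L ∈ allLists t (labels m u) ] 𝟙 (hasCounts (anchor r ∷ L) a b c) ≤
        configurationBound u t a b c
      anchor-≤ u t ih a zero c = nothing-≤ u t (allFin m) anchor {a} {zero} {c} (λ _ _ → refl)
      anchor-≤ u t ih a (suc b) c = begin
        ∑[ r ∈ allFin m ] #configurations u t a b c      ≤⟨ ∑-≤-length* (allFin m) (λ _ → ih a b c) ⟩
        length (allFin m) * configurationBound u t a b c ≡⟨ cong (_* configurationBound u t a b c) (length-allFin m) ⟩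
        m * (4 ^ t * (m ^ (a + b) * u ^ c))              ≡⟨ *-pull-middle m (4 ^ t) (m ^ (a + b)) (u ^ c) ⟩
        4 ^ t * (m ^ suc (a + b) * u ^ c)                ≡⟨ cong (λ e → 4 ^ t * (m ^ e * u ^ c)) (+-suc a b) ⟨
        4 ^ t * (m ^ (a + suc b) * u ^ c)                ∎
        where open ≤-Reasoning

      follower-≤ : ∀ u t → Bounded u t → ∀ a b c →
        ∑[ q ∈ upTo u ] ∑[ L ∈ allLists t (labels m u) ] 𝟙 (hasCounts (follower q ∷ L) a b c) ≤
        configurationBound u t a b c
      follower-≤ u t ih a b zero = nothing-≤ u t (upTo u) follower {a} {b} {zero} (λ _ _ → refl)
      follower-≤ u t ih a b (suc c) = begin
        ∑[ q ∈ upTo u ] #configurations u t a b c        ≤⟨ ∑-≤-length* (upTo u) (λ _ → ih a b c) ⟩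
        length (upTo u) * configurationBound u t a b c   ≡⟨ cong (_* configurationBound u t a b c) (length-upTo u) ⟩
        u * (4 ^ t * (m ^ (a + b) * u ^ c))              ≡⟨ *-pull-last u (4 ^ t) (m ^ (a + b)) (u ^ c) ⟩
        4 ^ t * (m ^ (a + b) * u ^ suc c)                ∎
        where open ≤-Reasoning

    #configurations-≤ : ∀ u t a b c → #configurations u t a b c ≤ configurationBound u t a b c
    #configurations-≤ u zero zero zero zero = ≤-refl
    #configurations-≤ u zero zero zero (suc c) = z≤n
    #configurations-≤ u zero zero (suc b) c = z≤n
    #configurations-≤ u zero (suc a) b c = z≤n
    #configurations-≤ u (suc t) a b c = begin
      #configurations u (suc t) a b c
        ≡⟨ ∑-allLists-suc t (labels m u) (λ L → 𝟙 (hasCounts L a b c)) ⟩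
      G unpinned + ∑ (map lone (allFin m) ++ map anchor (allFin m) ++ map follower (upTo u)) G
        ≡⟨ cong (G unpinned +_) (trans (∑-++ (map lone (allFin m)) _ G) (cong₂ _+_ (∑-map lone (allFin m) G)
             (trans (∑-++ (map anchor (allFin m)) _ G)
                    (cong₂ _+_ (∑-map anchor (allFin m) G) (∑-map follower (upTo u) G))))) ⟩
      G unpinned + (∑[ r ∈ allFin m ] G (lone r) + (∑[ r ∈ allFin m ] G (anchor r) + ∑[ q ∈ upTo u ] G (follower q)))
        ≤⟨ +-mono-≤ (ih a b c)
             (+-mono-≤ (lone-≤ u t ih a b c) (+-mono-≤ (anchor-≤ u t ih a b c) (follower-≤ u t ih a b c))) ⟩
      X + (X + (X + X))
        ≡⟨ cong (λ y → X + (X + (X + y))) (+-identityʳ X) ⟨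
      4 * X
        ≡⟨ *-assoc 4 (4 ^ t) (m ^ (a + b) * u ^ c) ⟨
      configurationBound u (suc t) a b c ∎
      where
      open ≤-Reasoning
      ih : Bounded u t
      ih = #configurations-≤ u t
      G : Label m → ℕ
      G l = ∑[ L ∈ allLists t (labels m u) ] 𝟙 (hasCounts (l ∷ L) a b c)
      X = configurationBound u t a b c

  ^-distribʳ-* : ∀ a b e → (a * b) ^ e ≡ a ^ e * b ^ e
  ^-distribʳ-* a b zero = refl
  ^-distribʳ-* a b (suc e) = trans (cong (a * b *_) (^-distribʳ-* a b e)) (*-interchange a b (a ^ e) (b ^ e))

  ^-double : ∀ a e → a ^ (2 * e) ≡ a ^ e * a ^ e
  ^-double a e = trans (cong (a ^_) (cong (e +_) (+-identityʳ e))) (^-distribˡ-+-* a e e)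

  1+n≤2^n : ∀ e → suc e ≤ 2 ^ e
  1+n≤2^n zero = ≤-refl
  1+n≤2^n (suc e) =
    +-mono-≤ (^-monoʳ-≤ 2 {0} {e} z≤n) (≤-trans (1+n≤2^n e) (≤-reflexive (sym (+-identityʳ (2 ^ e)))))

  power-term-square : ∀ m n u b d → m ^ b ≤ n ^ b → u ≤ n →
    m ^ b * u ^ (b + d) * (m ^ b * u ^ (b + d)) ≤ n ^ (b + b + d) * u ^ (b + b + d)
  power-term-square m n u b d m^b≤n^b u≤n = begin
    m ^ b * u ^ (b + d) * (m ^ b * u ^ (b + d))
      ≡⟨ cong (λ x → m ^ b * x * (m ^ b * x)) (^-distribˡ-+-* u b d) ⟩
    m ^ b * (u ^ b * u ^ d) * (m ^ b * (u ^ b * u ^ d))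
      ≡⟨ arrange₁ (m ^ b) (u ^ b) (u ^ d) ⟩
    m ^ b * m ^ b * (u ^ b * u ^ b) * (u ^ d * u ^ d)
      ≤⟨ *-mono-≤ (*-monoˡ-≤ (u ^ b * u ^ b) (*-mono-≤ m^b≤n^b m^b≤n^b)) (*-monoˡ-≤ (u ^ d) (^-monoˡ-≤ d u≤n)) ⟩
    n ^ b * n ^ b * (u ^ b * u ^ b) * (n ^ d * u ^ d)
      ≡⟨ arrange₂ (n ^ b) (u ^ b) (n ^ d) (u ^ d) ⟩
    n ^ b * n ^ b * n ^ d * (u ^ b * u ^ b * u ^ d)
      ≡⟨ cong₂ _*_ (^-triple n) (^-triple u) ⟨
    n ^ (b + b + d) * u ^ (b + b + d) ∎
    where
    open ≤-Reasoning
    arrange₁ : ∀ x y z → x * (y * z) * (x * (y * z)) ≡ x * x * (y * y) * (z * z)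
    arrange₁ = solve-∀
    arrange₂ : ∀ x y z w → x * x * (y * y) * (z * w) ≡ x * x * z * (y * y * w)
    arrange₂ = solve-∀
    ^-triple : ∀ a → a ^ (b + b + d) ≡ a ^ b * a ^ b * a ^ d
    ^-triple a = trans (^-distribˡ-+-* a (b + b) d) (cong (_* a ^ d) (^-distribˡ-+-* a b b))

  weighted-term-square : ∀ m n u η b → (2 * b ≤ η → m ^ b ≤ n ^ b) → u ≤ n →
    𝟙 (2 * b ≤ᵇ η) * (m ^ b * u ^ (η ∸ b)) * (𝟙 (2 * b ≤ᵇ η) * (m ^ b * u ^ (η ∸ b))) ≤ n ^ η * u ^ η
  weighted-term-square m n u η b m^b≤n^b u≤n with 2 * b ≤ᵇ η in 2b≤ᵇη
  ... | false = z≤n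
  ... | true = ≤-trans (≤-reflexive (cong₂ _*_ (+-identityʳ term) (+-identityʳ term)))
      (subst (λ e → term * term ≤ n ^ e * u ^ e) η≡
        (subst (λ e → m ^ b * u ^ e * (m ^ b * u ^ e) ≤ n ^ (b + b + d) * u ^ (b + b + d)) (sym η∸b≡)
        (power-term-square m n u b d (m^b≤n^b 2b≤η) u≤n)))
    where
    term = m ^ b * u ^ (η ∸ b)
    2b≤η : 2 * b ≤ η
    2b≤η = ≤ᵇ⇒≤ (2 * b) η (subst T (sym 2b≤ᵇη) tt)
    d = η ∸ (b + b)
    η≡ : b + b + d ≡ η
    η≡ = m+[n∸m]≡n (subst (_≤ η) (cong (b +_) (+-identityʳ b)) 2b≤η)
    η∸b≡ : η ∸ b ≡ b + d
    η∸b≡ = trans (cong (_∸ b) (trans (sym η≡) (+-assoc b b d))) (m+n∸m≡n b (b + d))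

  -- The squared bound of the theorem for C = 16 with denominators cleared, c counting the event
  -- among the N matrices.
  CountBound : ℕ → ℕ → ℕ → ℕ → ℕ → ℕ → ℕ → Set
  CountBound c N m n u κ η = c * n ^ κ * (c * n ^ κ) * n ^ η ≤ m ^ κ * m ^ κ * (16 ^ u * 16 ^ u) * u ^ η * (N * N)

  module _ {c N m n u κ η : ℕ} where

    private
      16^u≡ : 16 ^ u ≡ 2 ^ u * 4 ^ u * 2 ^ u
      16^u≡ = trans (^-distribʳ-* (2 * 4) 2 u) (cong (_* 2 ^ u) (^-distribʳ-* 2 4 u))

      raise-constant : ∀ {X} → X ≤ 16 ^ u →
        c * n ^ κ * (c * n ^ κ) * n ^ η ≤ m ^ κ * m ^ κ * (X * X) * u ^ η * (N * N) → CountBound c N m n u κ η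
      raise-constant X≤16^u bound =
        ≤-trans bound
          (*-monoˡ-≤ (N * N) (*-monoˡ-≤ (u ^ η) (*-monoʳ-≤ (m ^ κ * m ^ κ) (*-mono-≤ X≤16^u X≤16^u))))

      n^η≤[2^η]²u^η : n ≤ 4 * u → n ^ η ≤ 2 ^ η * 2 ^ η * u ^ η
      n^η≤[2^η]²u^η n≤4u = ≤-trans (^-monoˡ-≤ η n≤4u)
        (≤-reflexive (trans (^-distribʳ-* 4 u η) (cong (_* u ^ η) (^-distribʳ-* 2 2 η))))

    -- Each term of W = ∑_b 𝟙(2b ≤ η) m^b u^(η−b) has square at most n^η u^η, hence
    -- W² ≤ (η+1)² n^η u^η.
    countBound-multi : .{{NonZero n}} → u ≤ n → κ + η ≤ u → (∀ b → 2 * b ≤ η → m ^ b ≤ n ^ b) →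
      c * n ^ (κ + η) ≤
        2 ^ (κ + η) * N * ∑[ b ∈ upTo (suc η) ] (𝟙 (2 * b ≤ᵇ η) * (4 ^ u * (m ^ (κ + b) * u ^ (η ∸ b)))) →
      CountBound c N m n u κ η
    countBound-multi u≤n κ+η≤u m^b≤n^b counted =
      raise-constant X≤16^u (*-cancelʳ-≤ _ _ (n ^ η) {{m^n≢0 n η}} squared)
      where
      open ≤-Reasoning
      w : ℕ → ℕ
      w b = 𝟙 (2 * b ≤ᵇ η) * (m ^ b * u ^ (η ∸ b))
      W = ∑ (upTo (suc η)) w
      K = 2 ^ (κ + η) * N * (4 ^ u * m ^ κ)
      X = 2 ^ (κ + η) * 4 ^ u * suc η
      factor : ∀ b → 𝟙 (2 * b ≤ᵇ η) * (4 ^ u * (m ^ (κ + b) * u ^ (η ∸ b))) ≡ 4 ^ u * m ^ κ * w b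
      factor b = trans (cong (λ x → 𝟙 (2 * b ≤ᵇ η) * (4 ^ u * (x * u ^ (η ∸ b)))) (^-distribˡ-+-* m κ b))
                       (arrange (𝟙 (2 * b ≤ᵇ η)) (4 ^ u) (m ^ κ) (m ^ b) (u ^ (η ∸ b)))
        where
        arrange : ∀ i f p q v → i * (f * (p * q * v)) ≡ f * p * (i * (q * v))
        arrange = solve-∀
      c*n^[κ+η]≤K*W : c * n ^ (κ + η) ≤ K * W
      c*n^[κ+η]≤K*W = ≤-trans counted (≤-reflexive (trans (cong (2 ^ (κ + η) * N *_)
        (trans (∑-cong (upTo (suc η)) factor) (∑-*ˡ (upTo (suc η)) (4 ^ u * m ^ κ) w)))
        (sym (*-assoc (2 ^ (κ + η) * N) _ W))))
      w²≤ : ∀ b → w b * w b ≤ n ^ η * u ^ η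
      w²≤ b = weighted-term-square m n u η b (m^b≤n^b b) u≤n
      W²≤ : W * W ≤ suc η * (suc η * (n ^ η * u ^ η))
      W²≤ = subst (λ l → W * W ≤ l * (l * (n ^ η * u ^ η))) (length-upTo (suc η))
        (∑-square-≤ (upTo (suc η)) w (λ b b' → *-≤-of-squares {w b} {w b'} (w²≤ b) (w²≤ b')))
      squared : c * n ^ κ * (c * n ^ κ) * n ^ η * n ^ η ≤ m ^ κ * m ^ κ * (X * X) * u ^ η * (N * N) * n ^ η
      squared = begin
        c * n ^ κ * (c * n ^ κ) * n ^ η * n ^ η    ≡⟨ arrange₁ c (n ^ κ) (n ^ η) ⟩
        c * (n ^ κ * n ^ η) * (c * (n ^ κ * n ^ η)) ≡⟨ cong (λ x → c * x * (c * x)) (^-distribˡ-+-* n κ η) ⟨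
        c * n ^ (κ + η) * (c * n ^ (κ + η))        ≤⟨ *-mono-≤ c*n^[κ+η]≤K*W c*n^[κ+η]≤K*W ⟩
        K * W * (K * W)                            ≡⟨ arrange₂ K W ⟩
        K * K * (W * W)                            ≤⟨ *-monoʳ-≤ (K * K) W²≤ ⟩
        K * K * (suc η * (suc η * (n ^ η * u ^ η)))
          ≡⟨ arrange₃ (2 ^ (κ + η)) N (4 ^ u) (m ^ κ) (suc η) (n ^ η) (u ^ η) ⟩
        m ^ κ * m ^ κ * (X * X) * u ^ η * (N * N) * n ^ η ∎
        where
        arrange₁ : ∀ x p q → x * p * (x * p) * q * q ≡ x * (p * q) * (x * (p * q))
        arrange₁ = solve-∀
        arrange₂ : ∀ x y → x * y * (x * y) ≡ x * x * (y * y)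
        arrange₂ = solve-∀
        arrange₃ : ∀ a b f p s q v →
          a * b * (f * p) * (a * b * (f * p)) * (s * (s * (q * v))) ≡ p * p * (a * f * s * (a * f * s)) * v * (b * b) * q
        arrange₃ = solve-∀
      X≤16^u : X ≤ 16 ^ u
      X≤16^u = ≤-trans
        (*-mono-≤ (*-monoˡ-≤ (4 ^ u) (^-monoʳ-≤ 2 κ+η≤u)) (≤-trans (1+n≤2^n η) (^-monoʳ-≤ 2 (m+n≤o⇒n≤o κ κ+η≤u))))
        (≤-reflexive (sym 16^u≡))

    countBound-single : n ≤ 4 * u → κ + η ≤ u →
      c * n ^ κ ≤ 2 ^ κ * N * (4 ^ u * (m ^ (κ + 0) * u ^ 0)) → CountBound c N m n u κ η
    countBound-single n≤4u κ+η≤u counted = raise-constant X≤16^u (begin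
      c * n ^ κ * (c * n ^ κ) * n ^ η
        ≤⟨ *-mono-≤ (*-mono-≤ counted counted) (n^η≤[2^η]²u^η n≤4u) ⟩
      K * K * (2 ^ η * 2 ^ η * u ^ η)
        ≡⟨ cong (λ p → 2 ^ κ * N * (4 ^ u * (p * 1)) * (2 ^ κ * N * (4 ^ u * (p * 1))) * (2 ^ η * 2 ^ η * u ^ η))
             (cong (m ^_) (+-identityʳ κ)) ⟩
      2 ^ κ * N * (4 ^ u * (m ^ κ * 1)) * (2 ^ κ * N * (4 ^ u * (m ^ κ * 1))) * (2 ^ η * 2 ^ η * u ^ η)
        ≡⟨ arrange (2 ^ κ) N (4 ^ u) (m ^ κ) (2 ^ η) (u ^ η) ⟩
      m ^ κ * m ^ κ * (X * X) * u ^ η * (N * N) ∎)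
      where
      open ≤-Reasoning
      K = 2 ^ κ * N * (4 ^ u * (m ^ (κ + 0) * u ^ 0))
      X = 2 ^ κ * 4 ^ u * 2 ^ η
      arrange : ∀ a b f p e v →
        a * b * (f * (p * 1)) * (a * b * (f * (p * 1))) * (e * e * v) ≡ p * p * (a * f * e * (a * f * e)) * v * (b * b)
      arrange = solve-∀
      X≤16^u : X ≤ 16 ^ u
      X≤16^u = ≤-trans
        (*-mono-≤ (*-monoˡ-≤ (4 ^ u) (^-monoʳ-≤ 2 (m+n≤o⇒m≤o κ κ+η≤u))) (^-monoʳ-≤ 2 (m+n≤o⇒n≤o κ κ+η≤u)))
        (≤-reflexive (sym 16^u≡))

    countBound-trivial : c ≤ N → n ≤ 2 * m → n ≤ 4 * u → κ + η ≤ u → CountBound c N m n u κ η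
    countBound-trivial c≤N n≤2m n≤4u κ+η≤u = raise-constant X≤16^u (begin
      c * n ^ κ * (c * n ^ κ) * n ^ η
        ≤⟨ *-mono-≤ (*-mono-≤ c*n^κ≤ c*n^κ≤) (n^η≤[2^η]²u^η n≤4u) ⟩
      N * (2 ^ κ * m ^ κ) * (N * (2 ^ κ * m ^ κ)) * (2 ^ η * 2 ^ η * u ^ η)
        ≡⟨ arrange N (2 ^ κ) (m ^ κ) (2 ^ η) (u ^ η) ⟩
      m ^ κ * m ^ κ * (X * X) * u ^ η * (N * N) ∎)
      where
      open ≤-Reasoning
      X = 2 ^ κ * 2 ^ η
      c*n^κ≤ : c * n ^ κ ≤ N * (2 ^ κ * m ^ κ)
      c*n^κ≤ = *-mono-≤ c≤N (≤-trans (^-monoˡ-≤ κ n≤2m) (≤-reflexive (^-distribʳ-* 2 m κ)))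
      arrange : ∀ b a p e v → b * (a * p) * (b * (a * p)) * (e * e * v) ≡ p * p * (a * e * (a * e)) * v * (b * b)
      arrange = solve-∀
      X≤16^u : X ≤ 16 ^ u
      X≤16^u = ≤-trans (≤-reflexive (sym (^-distribˡ-+-* 2 κ η)))
        (≤-trans (^-monoʳ-≤ 2 κ+η≤u) (^-monoˡ-≤ u (s≤s (s≤s z≤n))))

  countBound-powers : ∀ {c N m n u κ η} → CountBound c N m n u κ η →
    c ^ 2 * (n ^ (2 * κ) * 1 ^ (2 * u) * n ^ η) ≤ m ^ (2 * κ) * 16 ^ (2 * u) * u ^ η * N ^ 2
  countBound-powers {c} {N} {m} {n} {u} {κ} {η} bound = begin
    c ^ 2 * (n ^ (2 * κ) * 1 ^ (2 * u) * n ^ η)  ≡⟨ cong₂ (λ p o → c ^ 2 * (p * o * n ^ η)) (^-double n κ) (^-zeroˡ (2 * u)) ⟩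
    c ^ 2 * (n ^ κ * n ^ κ * 1 * n ^ η)          ≡⟨ arrangeˡ c (n ^ κ) (n ^ η) ⟩
    c * n ^ κ * (c * n ^ κ) * n ^ η              ≤⟨ bound ⟩
    m ^ κ * m ^ κ * (16 ^ u * 16 ^ u) * u ^ η * (N * N) ≡⟨ arrangeʳ (m ^ κ) (16 ^ u) (u ^ η) N ⟩
    m ^ κ * m ^ κ * (16 ^ u * 16 ^ u) * u ^ η * N ^ 2 ≡⟨ cong₂ (λ p s → p * s * u ^ η * N ^ 2) (^-double m κ) (^-double 16 u) ⟨
    m ^ (2 * κ) * 16 ^ (2 * u) * u ^ η * N ^ 2   ∎
    where
    open ≤-Reasoning
    arrangeˡ : ∀ x p q → x * (x * 1) * (p * p * 1 * q) ≡ x * p * (x * p) * q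
    arrangeˡ = solve-∀
    arrangeʳ : ∀ p s v x → p * p * (s * s) * v * (x * x) ≡ p * p * (s * s) * v * (x * (x * 1))
    arrangeʳ = solve-∀

  module Event {m k n : ℕ} (U : SubsetNK n k) (κ η : ℕ) where

    u : ℕ
    u = card U

    N : ℕ
    N = length (PHM m k n)

    configurations : List (List (Label m))
    configurations = allLists u (labels m u)

    inEvent : Matrix m k n → Bool
    inEvent M = ⌊ kappa U M ≟ℕ κ ⌋ ∧ ⌊ eta U M ≟ℕ η ⌋

    #event : ℕ
    #event = #PHM inEvent

    countEvent≡#event : countEvent m k n U κ η ≡ #event
    countEvent≡#event = length-filter≡∑ inEvent (PHM m k n)

    isPHM-∈ : ∀ {M} → M ∈ PHM m k n → T (isPHM M)
    isPHM-∈ M∈ =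
      subst T (sym (proj₂ (∈-filter⁻ (λ M → isPHM M Bool.≟ true) {xs = allMatrices m k n} M∈))) tt

    inEvent⁻ : ∀ {M} → T (inEvent M) → kappa U M ≡ κ × eta U M ≡ η
    inEvent⁻ {M} t with Equivalence.to (T-∧ {⌊ kappa U M ≟ℕ κ ⌋}) t
    ... | tκ , tη = toWitness tκ , toWitness tη

    event-bound : ∀ t (w : List (Label m) → ℕ) → 2 * t ≤ n →
      (∀ {M} → T (isPHM M) → kappa U M ≡ κ → eta U M ≡ η →
        1 ≤ ∑[ L ∈ configurations ] (w L * 𝟙 (realises (pointsOf U) t L M))) →
      #event * n ^ t ≤ 2 ^ t * N * ∑ configurations w
    event-bound t w 2t≤n covered = begin
      #event * n ^ t
        ≤⟨ *-monoˡ-≤ (n ^ t) (union-bound (PHM m k n) inEvent configurations w (λ L → realises (pointsOf U) t L)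
             (λ M∈ inE → covered (isPHM-∈ M∈) (proj₁ (inEvent⁻ inE)) (proj₂ (inEvent⁻ inE)))) ⟩
      ∑[ L ∈ configurations ] (w L * #PHM (realises (pointsOf U) t L)) * n ^ t
        ≡⟨ ∑-*ʳ configurations _ (n ^ t) ⟨
      ∑[ L ∈ configurations ] (w L * #PHM (realises (pointsOf U) t L) * n ^ t)
        ≤⟨ ∑-mono configurations per-configuration ⟩
      ∑[ L ∈ configurations ] (2 ^ t * N * w L)
        ≡⟨ ∑-*ˡ configurations (2 ^ t * N) w ⟩
      2 ^ t * N * ∑ configurations w ∎
      where
      open ≤-Reasoning
      per-configuration : ∀ L → w L * #PHM (realises (pointsOf U) t L) * n ^ t ≤ 2 ^ t * N * w L
      per-configuration L = begin
        w L * #PHM (realises (pointsOf U) t L) * n ^ t   ≡⟨ *-assoc (w L) _ (n ^ t) ⟩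
        w L * (#PHM (realises (pointsOf U) t L) * n ^ t)
          ≤⟨ *-monoʳ-≤ (w L) (#realising-^ (pointsOf U) (pointsOf-unique U) t L 2t≤n) ⟩
        w L * (2 ^ t * N)                                ≡⟨ *-comm (w L) (2 ^ t * N) ⟩
        2 ^ t * N * w L ∎

    covered-by : ∀ {M} (phm : T (isPHM M)) multi t (w : List (Label m) → ℕ) →
      #pinned (Labelling.configuration U M phm multi) ≡ t → 1 ≤ w (Labelling.configuration U M phm multi) →
      1 ≤ ∑[ L ∈ configurations ] (w L * 𝟙 (realises (pointsOf U) t L M))
    covered-by {M} phm multi t w pinned≡t 1≤w = begin
      1                                          ≤⟨ 1≤w ⟩
      w L₀                                       ≡⟨ *-identityʳ (w L₀) ⟨
      w L₀ * 1                                   ≡⟨ cong (w L₀ *_) (𝟙-T realised) ⟨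
      g L₀                                       ≤⟨ subst (λ l → g L₀ ≤ ∑ (allLists l (labels m u)) g)
                                                      (length-map (label multi) (pointsOf U))
                                                      (∑-allLists-member (labels m u) g L₀ (configuration-labels multi)) ⟩
      ∑[ L ∈ configurations ] (w L * 𝟙 (realises (pointsOf U) t L M)) ∎
      where
      open ≤-Reasoning
      open Labelling U M phm
      L₀ = configuration multi
      g : List (Label m) → ℕ
      g L = w L * 𝟙 (realises (pointsOf U) t L M)
      realised : T (realises (pointsOf U) t L₀ M)
      realised = subst (λ t → T (realises (pointsOf U) t L₀ M)) pinned≡t (configuration-realises multi)

    multiWeight : List (Label m) → ℕ
    multiWeight L = ∑[ b ∈ upTo (suc η) ] (𝟙 (2 * b ≤ᵇ η) * 𝟙 (hasCounts L κ b (η ∸ b)))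

    #event-multi : 2 * (κ + η) ≤ n → #event * n ^ (κ + η) ≤ 2 ^ (κ + η) * N * ∑ configurations multiWeight
    #event-multi 2[κ+η]≤n = event-bound (κ + η) multiWeight 2[κ+η]≤n covered
      where
      covered : ∀ {M} → T (isPHM M) → kappa U M ≡ κ → eta U M ≡ η →
        1 ≤ ∑[ L ∈ configurations ] (multiWeight L * 𝟙 (realises (pointsOf U) (κ + η) L M))
      covered {M} phm κ≡ η≡ = covered-by phm true (κ + η) multiWeight pinned≡ 1≤weight
        where
        open Labelling U M phm
        L₀ = configuration true
        b₀ = #anchor L₀
        anchors+followers : b₀ + #follower L₀ ≡ η
        anchors+followers = trans #anchor+#follower-configuration (trans (sym eta≡multiSum) η≡)
        2b₀≤η : 2 * b₀ ≤ η
        2b₀≤η = ≤-trans (*-monoʳ-≤ 2 #anchor≤multiEdges)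
                        (≤-trans 2*multiEdges≤multiSum (≤-reflexive (trans (sym eta≡multiSum) η≡)))
        pinned≡ : #pinned L₀ ≡ κ + η
        pinned≡ = trans (+-assoc (#lone L₀) b₀ _) (cong₂ _+_ (trans (#lone-configuration true) κ≡) anchors+followers)
        counts : hasCounts L₀ κ b₀ (η ∸ b₀) ≡ true
        counts = subst₂ (λ a c → hasCounts L₀ a b₀ c ≡ true) (trans (#lone-configuration true) κ≡)
          (trans (sym (m+n∸m≡n b₀ (#follower L₀))) (cong (_∸ b₀) anchors+followers)) (hasCounts-self L₀)
        1≤weight : 1 ≤ multiWeight L₀
        1≤weight = subst (_≤ multiWeight L₀) (cong₂ _*_ (𝟙-T (≤⇒≤ᵇ 2b₀≤η)) (cong 𝟙 counts))
          (∑-member (λ b → 𝟙 (2 * b ≤ᵇ η) * 𝟙 (hasCounts L₀ κ b (η ∸ b)))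
            (∈-upTo⁺ (s≤s (≤-trans (m≤m+n b₀ (#follower L₀)) (≤-reflexive anchors+followers)))))

    #event-single : 2 * κ ≤ n → #event * n ^ κ ≤ 2 ^ κ * N * ∑[ L ∈ configurations ] 𝟙 (hasCounts L κ 0 0)
    #event-single 2κ≤n = event-bound κ (λ L → 𝟙 (hasCounts L κ 0 0)) 2κ≤n covered
      where
      covered : ∀ {M} → T (isPHM M) → kappa U M ≡ κ → eta U M ≡ η →
        1 ≤ ∑[ L ∈ configurations ] (𝟙 (hasCounts L κ 0 0) * 𝟙 (realises (pointsOf U) κ L M))
      covered {M} phm κ≡ _ =
        covered-by phm false κ (λ L → 𝟙 (hasCounts L κ 0 0)) pinned≡ (≤-reflexive (sym (cong 𝟙 counts)))
        where
        open Labelling U M phm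
        L₀ = configuration false
        no-anchors : #anchor L₀ ≡ 0
        no-anchors = m+n≡0⇒m≡0 (#anchor L₀) #anchor+#follower-single
        no-followers : #follower L₀ ≡ 0
        no-followers = m+n≡0⇒n≡0 (#anchor L₀) #anchor+#follower-single
        lones : #lone L₀ ≡ κ
        lones = trans (#lone-configuration false) κ≡
        pinned≡ : #pinned L₀ ≡ κ
        pinned≡ = trans (cong₂ (λ a f → #lone L₀ + a + f) no-anchors no-followers)
                        (trans (+-identityʳ _) (trans (+-identityʳ _) lones))
        counts : hasCounts L₀ κ 0 0 ≡ true
        counts = subst₂ (λ a b → hasCounts L₀ a b 0 ≡ true) lones no-anchors
          (subst (λ c → hasCounts L₀ (#lone L₀) (#anchor L₀) c ≡ true) no-followers (hasCounts-self L₀))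

    ∑-multiWeight :
      ∑ configurations multiWeight ≤ ∑[ b ∈ upTo (suc η) ] (𝟙 (2 * b ≤ᵇ η) * configurationBound u u κ b (η ∸ b))
    ∑-multiWeight = begin
      ∑ configurations multiWeight
        ≡⟨ ∑-comm configurations (upTo (suc η)) _ ⟩
      ∑[ b ∈ upTo (suc η) ] ∑[ L ∈ configurations ] (𝟙 (2 * b ≤ᵇ η) * 𝟙 (hasCounts L κ b (η ∸ b)))
        ≡⟨ ∑-cong (upTo (suc η)) (λ b → ∑-*ˡ configurations (𝟙 (2 * b ≤ᵇ η)) _) ⟩
      ∑[ b ∈ upTo (suc η) ] (𝟙 (2 * b ≤ᵇ η) * #configurations {m} u u κ b (η ∸ b))
        ≤⟨ ∑-mono (upTo (suc η)) (λ b → *-monoʳ-≤ (𝟙 (2 * b ≤ᵇ η)) (#configurations-≤ {m} u u κ b (η ∸ b))) ⟩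
      ∑[ b ∈ upTo (suc η) ] (𝟙 (2 * b ≤ᵇ η) * configurationBound u u κ b (η ∸ b)) ∎
      where open ≤-Reasoning

    kappa+eta≤card : ∀ {M : Matrix m k n} → T (isPHM M) → kappa U M + eta U M ≤ u
    kappa+eta≤card {M} phm = begin
      kappa U M + eta U M  ≡⟨ cong₂ _+_ (#lone-configuration true) (trans #anchor+#follower-configuration (sym eta≡multiSum)) ⟨
      #lone L₀ + (#anchor L₀ + #follower L₀) ≡⟨ +-assoc (#lone L₀) _ _ ⟨
      #pinned L₀           ≤⟨ #pinned-≤-length L₀ ⟩
      length L₀            ≡⟨ length-map (label true) (pointsOf U) ⟩
      u                    ∎
      where
      open ≤-Reasoning
      open Labelling U M phm
      L₀ = configuration true

    #event-empty : u < κ + η → #event ≡ 0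
    #event-empty u<κ+η = n≤0⇒n≡0 (≤-trans (∑-mono-∈ (PHM m k n) no-event) (≤-reflexive (∑-zero (PHM m k n))))
      where
      no-event : ∀ {M} → M ∈ PHM m k n → 𝟙 (inEvent M) ≤ 0
      no-event {M} M∈ with inEvent M in inE
      ... | false = z≤n
      ... | true with inEvent⁻ {M} (subst T (sym inE) tt)
      ...   | κ≡ , η≡ = ⊥-elim (<⇒≱ u<κ+η (subst₂ (λ a b → a + b ≤ u) κ≡ η≡ (kappa+eta≤card {M} (isPHM-∈ M∈))))

    #event≤N : #event ≤ N
    #event≤N = ≤-trans (∑-mono (PHM m k n) (λ M → 𝟙≤1 (inEvent M))) (≤-reflexive (∑-one (PHM m k n)))

    event-κ≤m : 1 ≤ #event → κ ≤ m
    event-κ≤m 1≤#event with ∑-𝟙-witness inEvent (PHM m k n) 1≤#event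
    ... | M , _ , inE = subst (_≤ m) (proj₁ (inEvent⁻ inE))
          (≤-trans (length-filter (λ j → inK U M j Bool.≟ true) (allFin m)) (≤-reflexive (length-allFin m)))

    m≤n : 1 ≤ N → 1 ≤ u → m ≤ n
    m≤n 1≤N 1≤u with ∈-nonempty (PHM m k n) 1≤N | ∈-nonempty (pointsOf U) 1≤u
    ... | M , M∈ | (_ , ℓ) , _ = injective⇒≤ (phm-column-injective {M = M} (isPHM-∈ M∈) ℓ)

    #event-countBound : .{{NonZero n}} → 1 ≤ N → κ + η ≤ u → CountBound #event N m n u κ η
    #event-countBound 1≤N κ+η≤u with 4 * u ≤? n
    ... | yes 4u≤n = countBound-multi {#event} {N} {m} {n} {u} {κ} {η} (≤-trans (m≤n*m u 4) 4u≤n) κ+η≤u m^b≤n^b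
            (≤-trans (#event-multi 2[κ+η]≤n) (*-monoʳ-≤ (2 ^ (κ + η) * N) ∑-multiWeight))
      where
      2[κ+η]≤n : 2 * (κ + η) ≤ n
      2[κ+η]≤n = ≤-trans (*-monoʳ-≤ 2 κ+η≤u) (≤-trans (*-monoˡ-≤ u {2} {4} (s≤s (s≤s z≤n))) 4u≤n)
      m^b≤n^b : ∀ b → 2 * b ≤ η → m ^ b ≤ n ^ b
      m^b≤n^b zero _ = ≤-refl
      m^b≤n^b (suc b) 2b≤η = ^-monoˡ-≤ (suc b) (m≤n 1≤N (≤-trans (s≤s z≤n) (≤-trans 2b≤η (m+n≤o⇒n≤o κ κ+η≤u))))
    ... | no 4u≰n with 2 * κ ≤? n
    ...   | yes 2κ≤n = countBound-single {#event} {N} {m} {n} {u} {κ} {η} (<⇒≤ (≰⇒> 4u≰n)) κ+η≤u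
              (≤-trans (#event-single 2κ≤n) (*-monoʳ-≤ (2 ^ κ * N) (#configurations-≤ {m} u u κ 0 0)))
    ...   | no 2κ≰n with #event | #event≤N | event-κ≤m
    ...     | zero | _ | _ = z≤n
    ...     | suc c | c≤N | κ≤m =
      countBound-trivial {suc c} {N} {m} {n} {u} {κ} {η} c≤N n≤2m (<⇒≤ (≰⇒> 4u≰n)) κ+η≤u
      where
      n≤2m : n ≤ 2 * m
      n≤2m = ≤-trans (<⇒≤ (≰⇒> 2κ≰n)) (*-monoʳ-≤ 2 (κ≤m (s≤s z≤n)))

    countEvent-bound : .{{NonZero n}} → 1 ≤ N → κ + η ≤ u →
      countEvent m k n U κ η ^ 2 * (n ^ (2 * κ) * 1 ^ (2 * u) * n ^ η) ≤ m ^ (2 * κ) * 16 ^ (2 * u) * u ^ η * N ^ 2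
    countEvent-bound 1≤N κ+η≤u = countBound-powers {countEvent m k n U κ η} {N} {m} {n} {u} {κ} {η}
      (subst (λ c → CountBound c N m n u κ η) (sym countEvent≡#event) (#event-countBound 1≤N κ+η≤u))

open CountingBound

open import Data.Integer using (+_; +≤+)
import Data.Integer as ℤ
import Data.Integer.Properties as ℤ
import Data.Nat as ℕ
open import Data.Rational using (ℚ; _/_; 0ℚ; toℚᵘ) renaming (_≤_ to _≤ℚ_; _*_ to _*ℚ_)
import Data.Rational.Properties as ℚ
open import Data.Rational.Unnormalised using (mkℚᵘ; _≃_; *≤*)
import Data.Rational.Unnormalised.Properties as ℚᵘ
open import Defs using (_^_)

-- Fractions

-- q ≐ a ÷ d says q = a / d with d ≥ 1 (mkℚᵘ stores the denominator minus one).
_≐_÷_ : ℚ → ℕ → ℕ → Set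
q ≐ a ÷ d = ∃ λ d-1 → d ≡ suc d-1 × toℚᵘ q ≃ mkℚᵘ (+ a) d-1

≐-/ : ∀ a d .{{_ : NonZero d}} → ((+ a) / d) ≐ a ÷ d
≐-/ a (suc d-1) = d-1 , refl , ℚ.toℚᵘ-fromℚᵘ (mkℚᵘ (+ a) d-1)

≐-* : ∀ {p q a b c d} → p ≐ a ÷ c → q ≐ b ÷ d → (p *ℚ q) ≐ a * b ÷ (c * d)
≐-* {p} {q} {a} {b} (c-1 , refl , p≃) (d-1 , refl , q≃) =
  d-1 + c-1 * suc d-1 , refl , ℚᵘ.≃-trans (ℚ.toℚᵘ-homo-* p q) (ℚᵘ.≃-trans (ℚᵘ.*-cong p≃ q≃)
    (ℚᵘ.≃-reflexive (cong (λ z → mkℚᵘ z (d-1 + c-1 * suc d-1)) (sym (ℤ.pos-* a b)))))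

≐-^ : ∀ {q a d} → q ≐ a ÷ d → ∀ e → (q ^ e) ≐ a ℕ.^ e ÷ (d ℕ.^ e)
≐-^ q≐ zero = 0 , refl , ℚᵘ.≃-refl
≐-^ q≐ (suc e) = ≐-* q≐ (≐-^ q≐ e)

≐-≤ : ∀ {p q a b c d} → p ≐ a ÷ c → q ≐ b ÷ d → a * d ≤ b * c → p ≤ℚ q
≐-≤ {p} {q} {a} {b} (c-1 , refl , p≃) (d-1 , refl , q≃) ad≤bc =
  ℚ.toℚᵘ-cancel-≤ (ℚᵘ.≤-respʳ-≃ (ℚᵘ.≃-sym q≃) (ℚᵘ.≤-respˡ-≃ (ℚᵘ.≃-sym p≃)
    (*≤* (subst₂ ℤ._≤_ (ℤ.pos-* a (suc d-1)) (ℤ.pos-* b (suc c-1)) (+≤+ ad≤bc)))))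

lemma7p8 : (k : ℕ) → ∃ λ (C : ℕ) →
    (n m : ℕ) → .{{_ : NonZero n}} → .{{_ : NonZero (length (PHM m k n))}} →
    (U : SubsetNK n k) → (κ η : ℕ) →
      ((κ + η ≤ card U) →
        (prob m k n U κ η) ^ 2 ≤ℚ
          ((((+ m) / n) ^ (2 * κ)) *ℚ (((+ C) / 1) ^ (2 * card U))) *ℚ (((+ card U) / n) ^ η))
      × ((κ + η > card U) → prob m k n U κ η ≡ 0ℚ)
lemma7p8 k = 16 , λ n m U κ η → bounded n m U κ η , vanishing n m U κ η
  where
  module _ (n m : ℕ) .{{_ : NonZero n}} .{{_ : NonZero (length (PHM m k n))}} (U : SubsetNK n k) (κ η : ℕ) where
    open Event {m} {k} {n} U κ η

    bounded : κ + η ≤ card U → prob m k n U κ η ^ 2 ≤ℚ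
      (((+ m) / n) ^ (2 * κ) *ℚ ((+ 16) / 1) ^ (2 * card U)) *ℚ ((+ card U) / n) ^ η
    bounded κ+η≤u = ≐-≤ (≐-^ (≐-/ (countEvent m k n U κ η) N) 2)
      (≐-* (≐-* (≐-^ (≐-/ m n) (2 * κ)) (≐-^ (≐-/ 16 1) (2 * u))) (≐-^ (≐-/ u n) η))
      (countEvent-bound (>-nonZero⁻¹ N) κ+η≤u)

    vanishing : κ + η > card U → prob m k n U κ η ≡ 0ℚ
    vanishing u<κ+η = trans (cong (λ c → (+ c) / N) (trans countEvent≡#event (#event-empty u<κ+η))) (ℚ.0/n≡0 N)
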